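{- Let $w\in S_n$. For every $D\in RP(w)$ and every $1\le i<n$, we have $\phi(e_i(D))=e_i(\phi(D))$, with the convention $\phi(0)=0$, and $e_i(D)=0$ if and only if $e_i(\phi(D))=0$.
   Context: Index the boxes of the $n\times n$ grid by $(i,j)$, row $i$ from the top, column $j$ from the left. Pipe dreams. A pipe dream is a covering of each box by a cross tile or an elbow tile, where crosses are only allowed in boxes with $i+j\le n$. Connecting tiles gives pipes that enter at the left of each row and exit at the top of a column: a cross lets one pipe pass horizontally and one vertically; an elbow joins the left edge to the top edge and the bottom edge to the right edge. $D$ is a pipe dream for $w$ if the pipe entering row $i$ exits from column $w(i)$. It is reduced if any two pipes cross at most once. $RP(w)$ is the set of reduced pipe dreams for $w$, and $D_+$ is the set of boxes carrying crosses. Pairing on pipe dreams (row $i$). The crosses of row $i$ are considered from right to left. The cross $(i,j)$ is paired with the leftmost not-yet-paired cross of row $i+1$ in a column $\ge j$, if one exists; otherwise it is unpaired. Crosses of row $i+1$ never paired are unpaired. $e_i$ on pipe dreams. If every cross of row $i+1$ is paired, set $e_i(D)=0$. Otherwise let $(i+1,\ell)$ be the rightmost unpaired cross of row $i+1$, let $q>\ell$ be minimal with $(i+1,q)\notin D_+$, and set $e_i(D)_+=(D_+\setminus\{(i+1,\ell)\})\cup\{(i,q)\}$. Reduced factorizations with cutoff. For $v\in S_n$, $RFC(v)$ is the set of reduced words $a_1\cdots a_p$ of $v$ (meaning $v=s_{a_1}\cdots s_{a_p}$, $p=\ell(v)$) divided into $n-1$ consecutive, possibly empty, blocks $r=(r^{n-1})\cdots(r^1)$,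 numbered right to left, with letters strictly increasing in each block and the leftmost letter of each nonempty $r^i$ at least $i$. Pairing on factorizations (block $i$). The letters of $r^i$ are considered from largest to smallest. A letter $a$ is paired with the smallest not-yet-paired letter $b$ of $r^{i+1}$ with $a<b$, if one exists; otherwise $a$ is unpaired. Letters of $r^{i+1}$ never paired are unpaired. $e_i$ on factorizations. If all letters of $r^{i+1}$ are paired, set $e_i(r)=0$. Otherwise let $v$ be the largest unpaired letter of $r^{i+1}$ and $s=\min\{z\ge v: z+1\notin r^{i+1}\}$. Let $e_i(r)$ be obtained by removing $v$ from $r^{i+1}$ and inserting $s$ into $r^i$. If this result is not in $RFC$, set $e_i(r)=0$. $\phi:RP(w)\to RFC(w^{ -1})$ sends $D$ to the factorization whose block $r^k$ consists of the numbers $k+j-1$ for crosses $(k,j)\in D_+$ in row $k$, in increasing order. -}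

module Defs where

-- Conventions: everything is 1-indexed as in the paper.  Rows, columns,
-- letters and the values of permutations are natural numbers; a permutation
-- w ∈ S_n is a stdlib 'Permutation′ n' (a bijection Fin n ↔ Fin n), and its
-- value at the 1-indexed point k = toℕ x + 1 is toℕ (w ⟨$⟩ʳ x) + 1.

open import Data.Bool using (Bool; true; false; if_then_else_; _∧_; T)
open import Data.Nat using (ℕ; zero; suc; _+_; _∸_; _≤_; _<_; _≡ᵇ_; _≤ᵇ_; _<ᵇ_; _⊔_)
open import Data.Fin using (Fin; toℕ)
open import Data.Fin.Permutation using (Permutation′; _⟨$⟩ʳ_)
open import Data.List using (List; []; _∷_; length; applyUpTo; filterᵇ; reverse; concat; foldr; map; allFin)
open import Data.Bool.ListAction using (all; any)
open import Data.List.Membership.Propositional using (_∈_)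
open import Data.Maybe using (Maybe; just; nothing)
open import Data.Product using (_×_; _,_; proj₁; proj₂)
open import Relation.Binary.PropositionalEquality using (_≡_; _≢_)

maxOf : ℕ → List ℕ → ℕ
maxOf x xs = foldr _⊔_ x xs

removeFirst : (ℕ → Bool) → List ℕ → List ℕ
removeFirst p [] = []
removeFirst p (x ∷ xs) = if p x then xs else x ∷ removeFirst p xs

elemᵇ : ℕ → List ℕ → Bool
elemᵇ x xs = any (x ≡ᵇ_) xs

-- sorted insertion (blocks are kept in increasing order)
insertSorted : ℕ → List ℕ → List ℕ
insertSorted s [] = s ∷ []
insertSorted s (x ∷ xs) = if s ≤ᵇ x then s ∷ x ∷ xs else x ∷ insertSorted s xs

strictIncᵇ : List ℕ → Bool
strictIncᵇ [] = true
strictIncᵇ (x ∷ []) = true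
strictIncᵇ (x ∷ y ∷ xs) = (x <ᵇ y) ∧ strictIncᵇ (y ∷ xs)

val : {n : ℕ} → Permutation′ n → Fin n → ℕ
val w x = suc (toℕ (w ⟨$⟩ʳ x))

invCount : (n : ℕ) → Permutation′ n → ℕ
invCount n v =
  length (filterᵇ (λ xy → (toℕ (proj₁ xy) <ᵇ toℕ (proj₂ xy)) ∧
                          (val v (proj₂ xy) <ᵇ val v (proj₁ xy)))
                  (concat (map (λ x → map (λ y → (x , y)) (allFin n)) (allFin n))))

sAct : ℕ → ℕ → ℕ
sAct a x = if x ≡ᵇ a then suc a else (if x ≡ᵇ suc a then a else x)

wordAct : List ℕ → ℕ → ℕ
wordAct [] x = x
wordAct (a ∷ as) x = sAct a (wordAct as x)

isReducedWordᵇ : (n : ℕ) → Permutation′ n → List ℕ → Bool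
isReducedWordᵇ n v ws =
  all (λ a → (1 ≤ᵇ a) ∧ (a <ᵇ n)) ws ∧
  (all (λ x → wordAct ws (suc (toℕ x)) ≡ᵇ val v x) (allFin n) ∧
   (length ws ≡ᵇ invCount n v))

-- A factorization r = (r^{n-1})⋯(r^1) is represented by the list of its
-- blocks  r^1 ∷ r^2 ∷ ⋯ ∷ r^{n-1} ∷ []  (block r^k at position k-1), each
-- block being the list of its letters from left to right.

Fact : Set
Fact = List (List ℕ)

-- block r^k (k ≥ 1); the empty block for indices beyond the list
block : Fact → ℕ → List ℕ
block [] k = []
block (b ∷ bs) zero = []
block (b ∷ bs) (suc zero) = b
block (b ∷ bs) (suc (suc k)) = block bs (suc k)

updBlock : ℕ → (List ℕ → List ℕ) → Fact → Fact
updBlock k f [] = []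
updBlock zero f bs = bs
updBlock (suc zero) f (b ∷ bs) = f b ∷ bs
updBlock (suc (suc k)) f (b ∷ bs) = b ∷ updBlock (suc k) f bs

cutoffᵇ : ℕ → Fact → Bool
cutoffᵇ k [] = true
cutoffᵇ k ([] ∷ bs) = cutoffᵇ (suc k) bs
cutoffᵇ k ((a ∷ as) ∷ bs) = (k ≤ᵇ a) ∧ cutoffᵇ (suc k) bs

factWord : Fact → List ℕ
factWord r = concat (reverse r)

isRFCᵇ : (n : ℕ) → Permutation′ n → Fact → Bool
isRFCᵇ n v r =
  (length r ≡ᵇ (n ∸ 1)) ∧
  (all strictIncᵇ r ∧ (cutoffᵇ 1 r ∧ isReducedWordᵇ n v (factWord r)))

RFC : (n : ℕ) → Permutation′ n → Fact → Set
RFC n v r = T (isRFCᵇ n v r)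

-- Pairing on factorizations (block i): the letters of r^i (given here from
-- largest to smallest) are processed in turn; the letter a is paired with
-- the smallest not-yet-paired b of r^{i+1} with a < b.
unpairedF : List ℕ → List ℕ → List ℕ
unpairedF [] avail = avail
unpairedF (a ∷ as) avail = unpairedF as (removeFirst (a <ᵇ_) avail)

-- s = min{ z ≥ v : z+1 ∉ b }  (search with fuel; length b + 1 steps suffice)
nextGapF : ℕ → List ℕ → ℕ → ℕ
nextGapF zero b z = z
nextGapF (suc f) b z = if elemᵇ (suc z) b then nextGapF f b (suc z) else z

-- e_i on factorizations (nothing = 0)
eF : (n : ℕ) → Permutation′ n → ℕ → Fact → Maybe Fact
eF n v i r with unpairedF (reverse (block r i)) (block r (suc i))
... | [] = nothing
... | (x ∷ xs) =
  let b = block r (suc i)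
      vv = maxOf x xs
      s = nextGapF (suc (length b)) b vv
      r′ = updBlock i (insertSorted s) (updBlock (suc i) (removeFirst (vv ≡ᵇ_)) r)
  in if isRFCᵇ n v r′ then just r′ else nothing

-- Pipe dreams.  A pipe dream is determined by its set of crosses D_+,
-- given as a Boolean predicate on boxes (i , j) (1-indexed).

PipeDream : Set
PipeDream = ℕ → ℕ → Bool

data Dir : Set where
  fromLeft fromBottom : Dir

-- Cross: left → right, bottom → top.  Elbow: left → top, bottom → right.
-- Leaving the top of row 1 in column j ends the pipe (exit column j).
-- Returns the list of boxes visited and the exit column (nothing if the
-- pipe leaves through the right edge or the fuel runs out; fuel 2n+2
-- always suffices since every step decreases i or increases j).
trace : (n : ℕ) → PipeDream → ℕ → ℕ → ℕ → Dir → List (ℕ × ℕ) × Maybe ℕ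
trace n D zero i j d = [] , nothing
trace n D (suc f) zero j d = [] , just j
trace n D (suc f) (suc i) j d with n <ᵇ j | D (suc i) j | d
... | true | _ | _ = [] , nothing
... | false | true  | fromLeft   = step (trace n D f (suc i) (suc j) fromLeft)
  where step : List (ℕ × ℕ) × Maybe ℕ → List (ℕ × ℕ) × Maybe ℕ
        step (ps , e) = ((suc i , j) ∷ ps) , e
... | false | true  | fromBottom = step (trace n D f i j fromBottom)
  where step : List (ℕ × ℕ) × Maybe ℕ → List (ℕ × ℕ) × Maybe ℕ
        step (ps , e) = ((suc i , j) ∷ ps) , e
... | false | false | fromLeft   = step (trace n D f i j fromBottom)
  where step : List (ℕ × ℕ) × Maybe ℕ → List (ℕ × ℕ) × Maybe ℕ
        step (ps , e) = ((suc i , j) ∷ ps) , e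
... | false | false | fromBottom = step (trace n D f (suc i) (suc j) fromLeft)
  where step : List (ℕ × ℕ) × Maybe ℕ → List (ℕ × ℕ) × Maybe ℕ
        step (ps , e) = ((suc i , j) ∷ ps) , e

pipe : (n : ℕ) → PipeDream → ℕ → List (ℕ × ℕ) × Maybe ℕ
pipe n D p = trace n D (suc (suc (n + n))) p 1 fromLeft

CrossesAllowed : ℕ → PipeDream → Set
CrossesAllowed n D = ∀ i j → D i j ≡ true → 1 ≤ i × 1 ≤ j × i + j ≤ n

IsPipeDreamFor : (n : ℕ) → Permutation′ n → PipeDream → Set
IsPipeDreamFor n w D =
  CrossesAllowed n D × (∀ (x : Fin n) → proj₂ (pipe n D (suc (toℕ x))) ≡ just (val w x))

-- reduced: two distinct pipes cross at most once (two pipes cross at a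
-- cross tile exactly when both pass through it)
IsReduced : (n : ℕ) → PipeDream → Set
IsReduced n D =
  ∀ (p q : Fin n) → p ≢ q → ∀ (c c′ : ℕ × ℕ) →
    D (proj₁ c) (proj₂ c) ≡ true → D (proj₁ c′) (proj₂ c′) ≡ true →
    c ∈ proj₁ (pipe n D (suc (toℕ p))) → c ∈ proj₁ (pipe n D (suc (toℕ q))) →
    c′ ∈ proj₁ (pipe n D (suc (toℕ p))) → c′ ∈ proj₁ (pipe n D (suc (toℕ q))) →
    c ≡ c′

RP : (n : ℕ) → Permutation′ n → PipeDream → Set
RP n w D = IsPipeDreamFor n w D × IsReduced n D

rowCols : ℕ → PipeDream → ℕ → List ℕ
rowCols n D i = filterᵇ (D i) (applyUpTo suc n)

-- Pairing on pipe dreams (row i): crosses of row i processed right to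
-- left; (i,j) is paired with the leftmost not-yet-paired cross of row i+1
-- in a column ≥ j.
unpairedPD : List ℕ → List ℕ → List ℕ
unpairedPD [] avail = avail
unpairedPD (j ∷ js) avail = unpairedPD js (removeFirst (j ≤ᵇ_) avail)

nextFree : PipeDream → ℕ → ℕ → ℕ → ℕ
nextFree D r zero q = q
nextFree D r (suc f) q = if D r q then nextFree D r f (suc q) else q

-- e_i on pipe dreams (nothing = 0)
ePD : (n : ℕ) → ℕ → PipeDream → Maybe PipeDream
ePD n i D with unpairedPD (reverse (rowCols n D i)) (rowCols n D (suc i))
... | [] = nothing
... | (x ∷ xs) =
  let ℓ = maxOf x xs
      q = nextFree D (suc i) (suc (suc n)) (suc ℓ)
  in just (λ a b → if (a ≡ᵇ suc i) ∧ (b ≡ᵇ ℓ) then false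
                   else (if (a ≡ᵇ i) ∧ (b ≡ᵇ q) then true else D a b))

φ : ℕ → PipeDream → Fact
φ n D = applyUpTo (λ k → map (λ j → suc k + j ∸ 1) (rowCols n D (suc k))) (n ∸ 1)

-- The crosses of D, read from the bottom row up and from left to right within each row, act on
-- pipe labels as the simple transpositions s_{i+j-1}.  Following a pipe through them shows that
-- this reading word, which is the word of φ(D), represents w⁻¹; and since two pipes never cross
-- twice, every letter is an ascent of the permutation read so far, so the word is reduced.
-- Shifting columns to letters turns the pairing of rows i, i+1 into the pairing of the blocks
-- r^i, r^{i+1}, so both operators pick the same unpaired cross, and φ(e_i D) is the
-- factorization obtained from φ(D) by the letter move of e_i.  It remains to see that the moved
-- factorization is again a reduced word of w⁻¹: around the moved letter v, r^{i+1} contains the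
-- run [v, s] and r^i the run [v, s - 1]; s ∉ r^i, as otherwise the word could be shortened by
-- two letters, and then moving v out of r^{i+1} and s into r^i is a braid-type identity.

module Submission where

open import Data.Bool using (Bool; true; false; if_then_else_; _∧_; _∨_; T)
open import Data.Bool.Properties using (T-≡; T-∧)
open import Data.Empty using (⊥; ⊥-elim)
open import Data.Fin using (Fin; toℕ; fromℕ<) renaming (zero to fzero; suc to fsuc)
open import Data.Fin.Permutation using (Permutation′; _⟨$⟩ˡ_; flip; inverseʳ)
open import Data.Fin.Properties using (toℕ-fromℕ<; toℕ<n)
open import Data.List using (List; []; _∷_; _++_; [_]; length; map; filterᵇ; reverse; concat; applyUpTo; allFin)
open import Data.List.Membership.Propositional using (_∈_; _∉_)
open import Data.List.Membership.Propositional.Properties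
  using (∈-++⁺ˡ; ∈-++⁺ʳ; ∈-++⁻; ∈-map⁺; ∈-map⁻; ∈-filter⁺; ∈-filter⁻; foldr-selective)
open import Data.List.Properties
  using (++-assoc; ++-identityʳ; map-++; map-∘; map-cong; map-id; map-tabulate; length-++; length-applyUpTo; length-filter;
         filter-++; filter-none; reverse-++; reverse-map; unfold-reverse; concat-++; applyUpTo-∷ʳ; foldr-preservesᵒ)
open import Data.List.Relation.Binary.Subset.Propositional using (_⊆_)
open import Data.List.Relation.Binary.Subset.Propositional.Properties using (⊆-reflexive; ⊆-trans; ∷⁺ʳ; xs⊆x∷xs)
open import Data.List.Relation.Unary.All as All using (All; []; _∷_)
import Data.List.Relation.Unary.All.Properties as AllP
open import Data.List.Relation.Unary.AllPairs as AllPairs using (AllPairs; []; _∷_)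
import Data.List.Relation.Unary.AllPairs.Properties as APP
open import Data.List.Relation.Unary.Any as Any using (Any; here; there)
open import Data.List.Relation.Unary.Any.Properties using (reverse⁺; reverse⁻)
open import Data.Maybe as Maybe using (Maybe; just; nothing)
open import Data.Maybe.Properties using (just-injective)
open import Data.Nat using (ℕ; zero; suc; _+_; _∸_; _≤_; _<_; _≡ᵇ_; _≤ᵇ_; _<ᵇ_; _⊔_; z≤n; s≤s; z<s; s<s)
open import Data.Nat.ListAction using (sum)
open import Data.Nat.Properties
open import Data.List.Membership.DecPropositional _≟_ using (_∈?_)
open import Data.Nat.Tactic.RingSolver using (solve-∀)
open import Data.Product using (_×_; _,_; proj₁; proj₂; ∃-syntax)
open import Data.Sum using (_⊎_; inj₁; inj₂; [_,_]′)
open import Data.Unit using (⊤)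
open import Function using (_∘_; id; case_of_)
open import Function.Bundles using (Equivalence; _⇔_; mk⇔)
open import Relation.Binary.Definitions using (tri<; tri≈; tri>)
open import Relation.Binary.PropositionalEquality hiding ([_])
open import Relation.Nullary using (¬_)
open import Relation.Nullary.Decidable using (T?; Dec; yes; no; _×-dec_)
open import Defs

module _ {m n : ℕ} where

  ≡ᵇ-true : m ≡ n → (m ≡ᵇ n) ≡ true
  ≡ᵇ-true m≡n = Equivalence.to T-≡ (≡⇒≡ᵇ m n m≡n)

  ≡ᵇ-false : m ≢ n → (m ≡ᵇ n) ≡ false
  ≡ᵇ-false m≢n with m ≡ᵇ n in eq
  ... | true  = ⊥-elim (m≢n (≡ᵇ⇒≡ m n (subst T (sym eq) _)))
  ... | false = refl

  ≡ᵇ-true⁻ : (m ≡ᵇ n) ≡ true → m ≡ n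
  ≡ᵇ-true⁻ eq = ≡ᵇ⇒≡ m n (subst T (sym eq) _)

  <ᵇ-true : m < n → (m <ᵇ n) ≡ true
  <ᵇ-true m<n = Equivalence.to T-≡ (<⇒<ᵇ m<n)

  <ᵇ-false : n ≤ m → (m <ᵇ n) ≡ false
  <ᵇ-false n≤m with m <ᵇ n in eq
  ... | true  = ⊥-elim (≤⇒≯ n≤m (<ᵇ⇒< m n (subst T (sym eq) _)))
  ... | false = refl

  <ᵇ-true⁻ : (m <ᵇ n) ≡ true → m < n
  <ᵇ-true⁻ eq = <ᵇ⇒< m n (subst T (sym eq) _)

  <ᵇ-false⁻ : (m <ᵇ n) ≡ false → n ≤ m
  <ᵇ-false⁻ eq = ≮⇒≥ (λ m<n → subst T eq (<⇒<ᵇ m<n))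

  ≤ᵇ-true : m ≤ n → (m ≤ᵇ n) ≡ true
  ≤ᵇ-true m≤n = Equivalence.to T-≡ (≤⇒≤ᵇ m≤n)

  ≤ᵇ-false : n < m → (m ≤ᵇ n) ≡ false
  ≤ᵇ-false n<m with m ≤ᵇ n in eq
  ... | true  = ⊥-elim (<⇒≱ n<m (≤ᵇ⇒≤ m n (subst T (sym eq) _)))
  ... | false = refl

≡ᵇ-refl : ∀ m → (m ≡ᵇ m) ≡ true
≡ᵇ-refl m = ≡ᵇ-true {m} {m} refl

<ᵇ-suc : ∀ m n → (m <ᵇ suc n) ≡ (m ≤ᵇ n)
<ᵇ-suc zero    n = refl
<ᵇ-suc (suc m) n = refl

≤ᵇ-+ˡ : ∀ k m n → (k + m ≤ᵇ k + n) ≡ (m ≤ᵇ n)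
≤ᵇ-+ˡ zero    m n = refl
≤ᵇ-+ˡ (suc k) m n = trans (<ᵇ-suc (k + m) (k + n)) (≤ᵇ-+ˡ k m n)

≡ᵇ-+ˡ : ∀ k m n → (k + m ≡ᵇ k + n) ≡ (m ≡ᵇ n)
≡ᵇ-+ˡ zero    m n = refl
≡ᵇ-+ˡ (suc k) m n = ≡ᵇ-+ˡ k m n

Far : ℕ → ℕ → Set
Far a x = x < a ⊎ suc a < x

Moved : ℕ → ℕ → Set
Moved a x = x ≡ a ⊎ x ≡ suc a

Distant : ℕ → ℕ → Set
Distant a b = suc a < b ⊎ suc b < a

moved-or-far : ∀ a x → Moved a x ⊎ Far a x
moved-or-far a x with <-cmp x a
... | tri< x<a _ _ = inj₂ (inj₁ x<a)
... | tri≈ _ x≡a _ = inj₁ (inj₁ x≡a)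
... | tri> _ _ a<x with m≤n⇒m<n∨m≡n a<x
...   | inj₁ 1+a<x = inj₂ (inj₂ 1+a<x)
...   | inj₂ 1+a≡x = inj₁ (inj₂ (sym 1+a≡x))

far⇒¬moved : ∀ {a x} → Far a x → ¬ Moved a x
far⇒¬moved (inj₁ x<a)   (inj₁ refl) = <-irrefl refl x<a
far⇒¬moved (inj₁ x<a)   (inj₂ refl) = <-asym x<a (n<1+n _)
far⇒¬moved (inj₂ 1+a<x) (inj₁ refl) = <-asym 1+a<x (n<1+n _)
far⇒¬moved (inj₂ 1+a<x) (inj₂ refl) = <-irrefl refl 1+a<x

distant-sym : ∀ {a b} → Distant a b → Distant b a
distant-sym (inj₁ lt) = inj₂ lt
distant-sym (inj₂ lt) = inj₁ lt

distant-far : ∀ {a b x} → Distant a b → Moved a x → Far b x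
distant-far (inj₁ 1+a<b) (inj₁ refl) = inj₁ (<-trans (n<1+n _) 1+a<b)
distant-far (inj₁ 1+a<b) (inj₂ refl) = inj₁ 1+a<b
distant-far (inj₂ 1+b<a) (inj₁ refl) = inj₂ 1+b<a
distant-far (inj₂ 1+b<a) (inj₂ refl) = inj₂ (<-trans 1+b<a (n<1+n _))

sAct-at : ∀ a → sAct a a ≡ suc a
sAct-at a rewrite ≡ᵇ-refl a = refl

sAct-next : ∀ a → sAct a (suc a) ≡ a
sAct-next a rewrite ≡ᵇ-false {suc a} {a} 1+n≢n | ≡ᵇ-refl a = refl

sAct-far : ∀ a x → Far a x → sAct a x ≡ x
sAct-far a x far rewrite ≡ᵇ-false (far⇒¬moved far ∘ inj₁) | ≡ᵇ-false (far⇒¬moved far ∘ inj₂) = refl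

sAct-moved : ∀ {a x} → Moved a x → Moved a (sAct a x)
sAct-moved {a} (inj₁ refl) = inj₂ (sAct-at a)
sAct-moved {a} (inj₂ refl) = inj₁ (sAct-next a)

sAct-involutive : ∀ a x → sAct a (sAct a x) ≡ x
sAct-involutive a x with moved-or-far a x
... | inj₁ (inj₁ refl) = trans (cong (sAct a) (sAct-at a)) (sAct-next a)
... | inj₁ (inj₂ refl) = trans (cong (sAct a) (sAct-next a)) (sAct-at a)
... | inj₂ far         = trans (cong (sAct a) (sAct-far a x far)) (sAct-far a x far)

sAct-injective : ∀ a {x y} → sAct a x ≡ sAct a y → x ≡ y
sAct-injective a {x} {y} eq =
  trans (sym (sAct-involutive a x)) (trans (cong (sAct a) eq) (sAct-involutive a y))

sAct-comm : ∀ {a b} x → Distant a b → sAct a (sAct b x) ≡ sAct b (sAct a x)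
sAct-comm {a} {b} x d with moved-or-far a x | moved-or-far b x
... | inj₁ ma | _ =
  trans (cong (sAct a) (sAct-far b x (distant-far d ma)))
        (sym (sAct-far b _ (distant-far d (sAct-moved ma))))
... | inj₂ _ | inj₁ mb =
  trans (sAct-far a _ (distant-far (distant-sym d) (sAct-moved mb)))
        (cong (sAct b) (sym (sAct-far a x (distant-far (distant-sym d) mb))))
... | inj₂ fa | inj₂ fb rewrite sAct-far b x fb | sAct-far a x fa | sAct-far b x fb = refl

wordAct-++ : ∀ xs ys x → wordAct (xs ++ ys) x ≡ wordAct xs (wordAct ys x)
wordAct-++ []       ys x = refl
wordAct-++ (a ∷ xs) ys x = cong (sAct a) (wordAct-++ xs ys x)

wordAct-injective : ∀ ws {x y} → wordAct ws x ≡ wordAct ws y → x ≡ y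
wordAct-injective []       eq = eq
wordAct-injective (a ∷ ws) eq = wordAct-injective ws (sAct-injective a eq)

wordAct-far : ∀ ws x → All (λ a → Far a x) ws → wordAct ws x ≡ x
wordAct-far []       x []         = refl
wordAct-far (a ∷ ws) x (far ∷ fs) rewrite wordAct-far ws x fs = sAct-far a x far

sAct-wordAct-comm : ∀ a ys x → All (Distant a) ys → sAct a (wordAct ys x) ≡ wordAct ys (sAct a x)
sAct-wordAct-comm a []       x []       = refl
sAct-wordAct-comm a (b ∷ ys) x (d ∷ ds) =
  trans (sAct-comm (wordAct ys x) d) (cong (sAct b) (sAct-wordAct-comm a ys x ds))

wordAct-comm : ∀ xs ys x → All (λ a → All (Distant a) ys) xs →
  wordAct xs (wordAct ys x) ≡ wordAct ys (wordAct xs x)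
wordAct-comm []       ys x []       = refl
wordAct-comm (a ∷ xs) ys x (d ∷ ds) =
  trans (cong (sAct a) (wordAct-comm xs ys x ds)) (sAct-wordAct-comm a ys (wordAct xs x) d)

range : ℕ → ℕ → List ℕ
range j zero    = []
range j (suc m) = j ∷ range (suc j) m

Increasing : List ℕ → Set
Increasing = AllPairs _<_

range-++ : ∀ j m k → range j (m + k) ≡ range j m ++ range (j + m) k
range-++ j zero    k = cong (λ i → range i k) (sym (+-identityʳ j))
range-++ j (suc m) k = cong (j ∷_) (trans (range-++ (suc j) m k) (cong (λ i → range (suc j) m ++ range i k) (sym (+-suc j m))))

range-∷ʳ : ∀ j m → range j (suc m) ≡ range j m ++ [ j + m ]
range-∷ʳ j m = trans (cong (range j) (+-comm 1 m)) (range-++ j m 1)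

length-range : ∀ j m → length (range j m) ≡ m
length-range j zero    = refl
length-range j (suc m) = cong suc (length-range (suc j) m)

range-bounds : ∀ j m → All (λ c → j ≤ c × c < j + m) (range j m)
range-bounds j zero    = []
range-bounds j (suc m) = (≤-refl , m<m+n j z<s) ∷ All.map weaken (range-bounds (suc j) m)
  where
  weaken : ∀ {c} → suc j ≤ c × c < suc j + m → j ≤ c × c < j + suc m
  weaken {c} (j<c , c<) = <⇒≤ j<c , subst (c <_) (sym (+-suc j m)) c<

∈-range⁺ : ∀ j m {c} → j ≤ c → c < j + m → c ∈ range j m
∈-range⁺ j zero    j≤c c<j = ⊥-elim (<-irrefl refl (<-≤-trans c<j (≤-trans (≤-reflexive (+-identityʳ j)) j≤c)))
∈-range⁺ j (suc m) {c} j≤c c< with m≤n⇒m<n∨m≡n j≤c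
... | inj₂ refl = here refl
... | inj₁ j<c  = there (∈-range⁺ (suc j) m j<c (subst (c <_) (+-suc j m) c<))

range-increasing : ∀ j m → Increasing (range j m)
range-increasing j zero    = []
range-increasing j (suc m) = All.map proj₁ (range-bounds (suc j) m) ∷ range-increasing (suc j) m

applyUpTo-cong : ∀ {A : Set} {f g : ℕ → A} → (∀ x → f x ≡ g x) → ∀ m → applyUpTo f m ≡ applyUpTo g m
applyUpTo-cong f≗g zero    = refl
applyUpTo-cong f≗g (suc m) = cong₂ _∷_ (f≗g 0) (applyUpTo-cong (f≗g ∘ suc) m)

applyUpTo-suc≡range : ∀ n → applyUpTo suc n ≡ range 1 n
applyUpTo-suc≡range = go 1
  where
  go : ∀ j m → applyUpTo (j +_) m ≡ range j m
  go j zero    = refl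
  go j (suc m) = cong₂ _∷_ (+-identityʳ j) (trans (applyUpTo-cong (+-suc j) m) (go (suc j) m))

range-far-below : ∀ j m x → x < j → All (λ a → Far a x) (range j m)
range-far-below j m x x<j = All.map (λ b → inj₁ (<-≤-trans x<j (proj₁ b))) (range-bounds j m)

cycle-shift : ∀ v k x → v ≤ x → x < v + k → wordAct (range v k) x ≡ suc x
cycle-shift v zero    x v≤x x<v+0 = ⊥-elim (<-irrefl refl (<-≤-trans x<v+0 (≤-trans (≤-reflexive (+-identityʳ v)) v≤x)))
cycle-shift v (suc k) x v≤x x<   with m≤n⇒m<n∨m≡n v≤x
... | inj₂ refl =
  trans (cong (sAct v) (wordAct-far (range (suc v) k) v (range-far-below (suc v) k v (n<1+n v)))) (sAct-at v)
... | inj₁ v<x  =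
  trans (cong (sAct v) (cycle-shift (suc v) k x v<x (subst (x <_) (+-suc v k) x<)))
        (sAct-far v (suc x) (inj₂ (s≤s v<x)))

module _ (v m t : ℕ) (v≤t : v ≤ t) (t<v+m : t < v + m) where

  private
    X : ℕ → ℕ
    X = wordAct (range v (suc m))

    X-t : X t ≡ suc t
    X-t = cycle-shift v (suc m) t v≤t (<-trans t<v+m (subst (v + m <_) (sym (+-suc v m)) (n<1+n _)))

    X-suc-t : X (suc t) ≡ suc (suc t)
    X-suc-t = cycle-shift v (suc m) (suc t) (≤-trans v≤t (n≤1+n t)) (subst (suc t <_) (sym (+-suc v m)) (s≤s t<v+m))

  cycle-conj : ∀ x → X (sAct t x) ≡ sAct (suc t) (X x)
  cycle-conj x with moved-or-far t x
  ... | inj₁ (inj₁ refl) =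
    trans (cong X (sAct-at t)) (trans X-suc-t (sym (trans (cong (sAct (suc t)) X-t) (sAct-at (suc t)))))
  ... | inj₁ (inj₂ refl) =
    trans (cong X (sAct-next t)) (trans X-t (sym (trans (cong (sAct (suc t)) X-suc-t) (sAct-next (suc t)))))
  ... | inj₂ far =
    trans (cong X (sAct-far t x far)) (sym (sAct-far (suc t) (X x) Xx-far))
    where
    Xx-far : Far (suc t) (X x)
    Xx-far with moved-or-far (suc t) (X x)
    ... | inj₂ far′ = far′
    ... | inj₁ (inj₁ Xx≡) = ⊥-elim (far⇒¬moved far (inj₁ (wordAct-injective (range v (suc m)) (trans Xx≡ (sym X-t)))))
    ... | inj₁ (inj₂ Xx≡) = ⊥-elim (far⇒¬moved far (inj₂ (wordAct-injective (range v (suc m)) (trans Xx≡ (sym X-suc-t)))))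

cycle-conj-range : ∀ v m t k → v ≤ t → t + k ≤ v + m → ∀ x →
  wordAct (range v (suc m)) (wordAct (range t k) x) ≡ wordAct (range (suc t) k) (wordAct (range v (suc m)) x)
cycle-conj-range v m t zero    v≤t t+k≤ x = refl
cycle-conj-range v m t (suc k) v≤t t+k≤ x =
  trans (cycle-conj v m t v≤t (<-≤-trans (subst (t <_) (sym (+-suc t k)) (s≤s (m≤m+n t k))) t+k≤) (wordAct (range (suc t) k) x))
        (cong (sAct (suc t)) (cycle-conj-range v m (suc t) k (≤-trans v≤t (n≤1+n t)) (subst (_≤ v + m) (+-suc t k) t+k≤) x))

cycle-braid : ∀ v m x →
  wordAct (range v (suc m)) (wordAct (range v m) x) ≡ wordAct (range (suc v) m) (wordAct (range v (suc m)) x)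
cycle-braid v m = cycle-conj-range v m v m ≤-refl ≤-refl

letter : ℕ × ℕ → ℕ
letter b = proj₁ b + proj₂ b ∸ 1

touch : ℕ → ℕ → Bool
touch a x = (x ≡ᵇ a) ∨ (x ≡ᵇ suc a)

-- Crossing b swaps the labels letter b and letter b + 1; 'visits bs x' are the crossings at
-- which the label that starts as x is swapped.
track : List (ℕ × ℕ) → ℕ → ℕ
track []       x = x
track (b ∷ bs) x = track bs (sAct (letter b) x)

visits : List (ℕ × ℕ) → ℕ → List (ℕ × ℕ)
visits []       x = []
visits (b ∷ bs) x =
  if touch (letter b) x then b ∷ visits bs (sAct (letter b) x) else visits bs (sAct (letter b) x)

touch-moved : ∀ {a x} → Moved a x → touch a x ≡ true
touch-moved {a} (inj₁ refl) rewrite ≡ᵇ-refl a = refl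
touch-moved {a} (inj₂ refl) rewrite ≡ᵇ-false {suc a} {a} 1+n≢n | ≡ᵇ-refl a = refl

touch-far : ∀ {a x} → Far a x → touch a x ≡ false
touch-far far rewrite ≡ᵇ-false (far⇒¬moved far ∘ inj₁) | ≡ᵇ-false (far⇒¬moved far ∘ inj₂) = refl

track-++ : ∀ bs cs x → track (bs ++ cs) x ≡ track cs (track bs x)
track-++ []       cs x = refl
track-++ (b ∷ bs) cs x = track-++ bs cs _

visits-++ : ∀ bs cs x → visits (bs ++ cs) x ≡ visits bs x ++ visits cs (track bs x)
visits-++ []       cs x = refl
visits-++ (b ∷ bs) cs x with touch (letter b) x
... | true  = cong (b ∷_) (visits-++ bs cs _)
... | false = visits-++ bs cs _

track-far : ∀ bs x → All (λ b → Far (letter b) x) bs → track bs x ≡ x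
track-far []       x []         = refl
track-far (b ∷ bs) x (far ∷ fs) rewrite sAct-far (letter b) x far = track-far bs x fs

visits-far : ∀ bs x → All (λ b → Far (letter b) x) bs → visits bs x ≡ []
visits-far []       x []         = refl
visits-far (b ∷ bs) x (far ∷ fs) rewrite touch-far far | sAct-far (letter b) x far = visits-far bs x fs

visits-⊆ : ∀ bs x → visits bs x ⊆ bs
visits-⊆ (b ∷ bs) x c∈ with touch (letter b) x
visits-⊆ (b ∷ bs) x (here refl) | true = here refl
visits-⊆ (b ∷ bs) x (there c∈)  | true = there (visits-⊆ bs _ c∈)
... | false = there (visits-⊆ bs _ c∈)

visits-moved : ∀ b bs x → Moved (letter b) x → visits (b ∷ bs) x ≡ b ∷ visits bs (sAct (letter b) x)
visits-moved b bs x moved rewrite touch-moved moved = refl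

visits-there : ∀ b bs x → visits bs (sAct (letter b) x) ⊆ visits (b ∷ bs) x
visits-there b bs x c∈ with touch (letter b) x
... | true  = there c∈
... | false = c∈

wordAct-track : ∀ bs x → wordAct (map letter bs) (track bs x) ≡ x
wordAct-track []       x = refl
wordAct-track (b ∷ bs) x =
  trans (cong (sAct (letter b)) (wordAct-track bs (sAct (letter b) x))) (sAct-involutive (letter b) x)

track-wordAct : ∀ bs x → track bs (wordAct (map letter bs) x) ≡ x
track-wordAct []       x = refl
track-wordAct (b ∷ bs) x = trans (cong (track bs) (sAct-involutive (letter b) _)) (track-wordAct bs x)

moved? : ∀ a x → Dec (Moved a x)
moved? a x with moved-or-far a x
... | inj₁ m = yes m
... | inj₂ f = no (far⇒¬moved f)

sAct-monotone : ∀ a {x y} → x < y → ¬ (Moved a x × Moved a y) → sAct a x < sAct a y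
sAct-monotone a {x} {y} x<y not-both with moved-or-far a x | moved-or-far a y
... | inj₁ mx | inj₁ my = ⊥-elim (not-both (mx , my))
... | inj₂ fx | inj₂ fy rewrite sAct-far a x fx | sAct-far a y fy = x<y
... | inj₁ (inj₁ refl) | inj₂ fy rewrite sAct-at x | sAct-far x y fy = ≤∧≢⇒< x<y (λ e → far⇒¬moved fy (inj₂ (sym e)))
... | inj₁ (inj₂ refl) | inj₂ fy rewrite sAct-next a | sAct-far a y fy = <-trans (n<1+n a) x<y
... | inj₂ fx | inj₁ (inj₁ refl) rewrite sAct-at y | sAct-far y x fx = <-trans x<y (n<1+n y)
... | inj₂ fx | inj₁ (inj₂ refl) rewrite sAct-next a | sAct-far a x fx = ≤∧≢⇒< (≤-pred x<y) (far⇒¬moved fx ∘ inj₁)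

inversion-meets : ∀ bs {x y} → x < y → track bs y < track bs x → ∃[ c ] (c ∈ visits bs x × c ∈ visits bs y)
inversion-meets []       x<y y>x = ⊥-elim (<-asym x<y y>x)
inversion-meets (b ∷ bs) {x} {y} x<y inv with moved? (letter b) x ×-dec moved? (letter b) y
... | yes (mx , my) = b , visits-here mx , visits-here my
  where
  visits-here : ∀ {z} → Moved (letter b) z → b ∈ visits (b ∷ bs) z
  visits-here {z} m = subst (b ∈_) (sym (visits-moved b bs z m)) (here refl)
... | no not-both with inversion-meets bs (sAct-monotone (letter b) x<y not-both) inv
...   | c , cx , cy = c , visits-there b bs x cx , visits-there b bs y cy

record SameRun (bs : List (ℕ × ℕ)) (x : ℕ) (cs : List (ℕ × ℕ)) (y : ℕ) : Set where
  constructor _,_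
  field
    same-track  : track bs x ≡ track cs y
    same-visits : visits bs x ≡ visits cs y

skip-far : ∀ bs cs x → All (λ b → Far (letter b) x) bs → SameRun (bs ++ cs) x cs x
skip-far bs cs x fs =
  trans (track-++ bs cs x) (cong (track cs) (track-far bs x fs)) ,
  trans (visits-++ bs cs x) (cong₂ _++_ (visits-far bs x fs) (cong (visits cs) (track-far bs x fs)))

SameRun-trans : ∀ {bs x cs y ds z} → SameRun bs x cs y → SameRun cs y ds z → SameRun bs x ds z
SameRun-trans (t₁ , v₁) (t₂ , v₂) = trans t₁ t₂ , trans v₁ v₂

ValidLetter : ℕ → ℕ → Set
ValidLetter n a = 1 ≤ a × a < n

φBlock : ℕ → PipeDream → ℕ → List ℕ
φBlock n D k = map (λ j → suc k + j ∸ 1) (rowCols n D (suc k))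

rowCols≡filter-range : ∀ n D r → rowCols n D r ≡ filterᵇ (D r) (range 1 n)
rowCols≡filter-range n D r = cong (filterᵇ (D r)) (applyUpTo-suc≡range n)

module PipeTracing (n : ℕ) (D : PipeDream) (allowed : CrossesAllowed n D) where

  rowCrosses : ℕ → ℕ → ℕ → List (ℕ × ℕ)
  rowCrosses k j m = map (k ,_) (filterᵇ (D k) (range j m))

  crossesUpTo : ℕ → List (ℕ × ℕ)
  crossesUpTo zero    = []
  crossesUpTo (suc k) = rowCrosses (suc k) 1 n ++ crossesUpTo k

  -- A pipe in box (k , j) entered from direction d carries the label 'label k j d' (its
  -- anti-diagonal, shifted by one when entering from below), and 'ahead k j' lists the
  -- crosses it may still meet, in the order it meets them.
  ahead : ℕ → ℕ → List (ℕ × ℕ)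
  ahead zero    j = []
  ahead (suc k) j = rowCrosses (suc k) j (suc n ∸ j) ++ crossesUpTo k

  label : ℕ → ℕ → Dir → ℕ
  label zero    j d          = j
  label (suc k) j fromLeft   = k + j
  label (suc k) j fromBottom = suc (k + j)

  label-fromBottom : ∀ k j → label k j fromBottom ≡ k + j
  label-fromBottom zero    j = refl
  label-fromBottom (suc k) j = refl

  rowCrosses-far-below : ∀ r j m x → x < r + j → All (λ b → Far (letter b) x) (rowCrosses (suc r) j m)
  rowCrosses-far-below r j m x x< =
    AllP.map⁺ (AllP.filter⁺ (T? ∘ D (suc r)) (All.map (λ b → inj₁ (≤-trans x< (+-monoʳ-≤ r (proj₁ b)))) (range-bounds j m)))

  rowCrosses-far-above : ∀ r j m x → r + (j + m) < x → All (λ b → Far (letter b) x) (rowCrosses (suc r) j m)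
  rowCrosses-far-above r j m x <x =
    AllP.map⁺ (AllP.filter⁺ (T? ∘ D (suc r)) (All.map far (range-bounds j m)))
    where
    far : ∀ {c} → j ≤ c × c < j + m → Far (r + c) x
    far {c} (_ , c<) = inj₂ (≤-<-trans (subst (_≤ r + (j + m)) (+-suc r c) (+-monoʳ-≤ r c<)) <x)

  rowCrosses-split : ∀ r j → j ≤ n → rowCrosses r 1 n ≡ rowCrosses r 1 j ++ rowCrosses r (suc j) (n ∸ j)
  rowCrosses-split r j j≤n = begin
    map (r ,_) (filterᵇ (D r) (range 1 n))
      ≡⟨ cong (λ m → map (r ,_) (filterᵇ (D r) (range 1 m))) (sym (m+[n∸m]≡n j≤n)) ⟩
    map (r ,_) (filterᵇ (D r) (range 1 (j + (n ∸ j))))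
      ≡⟨ cong (map (r ,_) ∘ filterᵇ (D r)) (range-++ 1 j (n ∸ j)) ⟩
    map (r ,_) (filterᵇ (D r) (range 1 j ++ range (suc j) (n ∸ j)))
      ≡⟨ cong (map (r ,_)) (filter-++ (T? ∘ D r) (range 1 j) _) ⟩
    map (r ,_) (filterᵇ (D r) (range 1 j) ++ filterᵇ (D r) (range (suc j) (n ∸ j)))
      ≡⟨ map-++ (r ,_) (filterᵇ (D r) (range 1 j)) _ ⟩
    rowCrosses r 1 j ++ rowCrosses r (suc j) (n ∸ j) ∎
    where open ≡-Reasoning

  climb : ∀ k j → 1 ≤ j → j ≤ n → SameRun (ahead (suc k) (suc j)) (k + j) (ahead k j) (k + j)
  climb k j 1≤j j≤n =
    SameRun-trans (skip-far (rowCrosses (suc k) (suc j) (n ∸ j)) (crossesUpTo k) (k + j)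
                            (rowCrosses-far-below k (suc j) (n ∸ j) (k + j) (≤-reflexive (sym (+-suc k j)))))
                  (enter-row k j 1≤j j≤n)
    where
    enter-row : ∀ k j → 1 ≤ j → j ≤ n → SameRun (crossesUpTo k) (k + j) (ahead k j) (k + j)
    enter-row zero    j       _   _   = refl , refl
    enter-row (suc k) (suc j) 1≤j j<n =
      subst (λ bs → SameRun bs (suc k + suc j) (ahead (suc k) (suc j)) (suc k + suc j))
            (sym (trans (cong (_++ crossesUpTo k) (rowCrosses-split (suc k) j (≤-trans (n≤1+n j) j<n)))
                        (++-assoc (rowCrosses (suc k) 1 j) _ (crossesUpTo k))))
            (skip-far (rowCrosses (suc k) 1 j) _ (suc k + suc j) (rowCrosses-far-above k 1 j (suc k + suc j) ≤-refl))

  ahead-cross : ∀ k j → j ≤ n → D (suc k) j ≡ true → ahead (suc k) j ≡ (suc k , j) ∷ ahead (suc k) (suc j)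
  ahead-cross k j j≤n cross rewrite +-∸-assoc 1 j≤n | cross = refl

  ahead-elbow : ∀ k j → j ≤ n → D (suc k) j ≡ false → ahead (suc k) j ≡ ahead (suc k) (suc j)
  ahead-elbow k j j≤n elbow rewrite +-∸-assoc 1 j≤n | elbow = refl

  record Step (b : ℕ × ℕ) (bs : List (ℕ × ℕ)) (x : ℕ) (cs : List (ℕ × ℕ)) (y : ℕ) : Set where
    constructor _,_
    field
      same-track     : track bs x ≡ track cs y
      visits-through : visits bs x ⊆ b ∷ visits cs y

  sameRun⇒step : ∀ {b bs x cs y} → SameRun bs x cs y → Step b bs x cs y
  sameRun⇒step {b} {cs = cs} {y} (t , v) = t , ⊆-trans (⊆-reflexive v) (xs⊆x∷xs (visits cs y) b)

  step-cross-left : ∀ k j → j ≤ n → D (suc k) j ≡ true →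
    Step (suc k , j) (ahead (suc k) j) (k + j) (ahead (suc k) (suc j)) (k + suc j)
  step-cross-left k j j≤n cross rewrite ahead-cross k j j≤n cross =
    cong (track bs) moved ,
    ⊆-reflexive (trans (visits-moved (suc k , j) bs (k + j) (inj₁ refl)) (cong (λ x → (suc k , j) ∷ visits bs x) moved))
    where
    bs : List (ℕ × ℕ)
    bs = ahead (suc k) (suc j)
    moved : sAct (k + j) (k + j) ≡ k + suc j
    moved = trans (sAct-at (k + j)) (sym (+-suc k j))

  step-elbow-left : ∀ k j → 1 ≤ j → j ≤ n → D (suc k) j ≡ false →
    Step (suc k , j) (ahead (suc k) j) (k + j) (ahead k j) (label k j fromBottom)
  step-elbow-left k j 1≤j j≤n elbow rewrite ahead-elbow k j j≤n elbow | label-fromBottom k j =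
    sameRun⇒step (climb k j 1≤j j≤n)

  step-cross-bottom : ∀ k j → 1 ≤ j → j ≤ n → D (suc k) j ≡ true →
    Step (suc k , j) (ahead (suc k) j) (suc (k + j)) (ahead k j) (label k j fromBottom)
  step-cross-bottom k j 1≤j j≤n cross
    rewrite ahead-cross k j j≤n cross | label-fromBottom k j with climb k j 1≤j j≤n
  ... | t , v =
    trans (cong (track bs) (sAct-next (k + j))) t ,
    ⊆-trans (⊆-reflexive (trans (visits-moved (suc k , j) bs (suc (k + j)) (inj₂ refl))
                                (cong (λ x → (suc k , j) ∷ visits bs x) (sAct-next (k + j)))))
            (∷⁺ʳ (suc k , j) (⊆-reflexive v))
    where
    bs : List (ℕ × ℕ)
    bs = ahead (suc k) (suc j)

  step-elbow-bottom : ∀ k j → j ≤ n → D (suc k) j ≡ false →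
    Step (suc k , j) (ahead (suc k) j) (suc (k + j)) (ahead (suc k) (suc j)) (k + suc j)
  step-elbow-bottom k j j≤n elbow rewrite ahead-elbow k j j≤n elbow | +-suc k j =
    refl , xs⊆x∷xs _ (suc k , j)

  record Traced (t : List (ℕ × ℕ) × Maybe ℕ) (bs : List (ℕ × ℕ)) (x : ℕ) : Set where
    constructor _,_
    field
      exit    : proj₂ t ≡ just (track bs x)
      on-pipe : visits bs x ⊆ proj₁ t

  advance : ∀ {b bs x cs y t} → Step b bs x cs y → Traced t cs y → Traced ((b ∷ proj₁ t) , proj₂ t) bs x
  advance {b} (t≡ , v⊆) (exit , seen) = trans exit (cong just (sym t≡)) , ⊆-trans v⊆ (∷⁺ʳ b seen)

  private
    fuel-right : ∀ k j f → j < n → suc k + (n ∸ j) < suc f → suc k + (n ∸ suc j) < f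
    fuel-right k j f j<n fuel =
      subst (_≤ f) (+-suc (suc k) (n ∸ suc j)) (≤-pred (subst (λ m → suc k + m < suc f) (+-∸-assoc 1 j<n) fuel))

    bottom-bound : ∀ k j → k + j ≤ n → label k j fromBottom ≤ n
    bottom-bound k j k+j≤n = subst (_≤ n) (sym (label-fromBottom k j)) k+j≤n

    crossing-bound : ∀ k j → D (suc k) j ≡ true → suc k + j ≤ n
    crossing-bound k j cross = proj₂ (proj₂ (allowed (suc k) j cross))

  trace-spec : ∀ f k j d → 1 ≤ j → label k j d ≤ n → k + (n ∸ j) < f →
    Traced (trace n D f k j d) (ahead k j) (label k j d)
  trace-spec zero    k       j d _ _ ()
  trace-spec (suc f) zero    j d _ _ _ = refl , λ ()
  trace-spec (suc f) (suc k) j fromLeft 1≤j ℓ≤n fuel with n <ᵇ j in off-grid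
  ... | true = ⊥-elim (<⇒≱ (<ᵇ-true⁻ off-grid) (≤-trans (m≤n+m j k) ℓ≤n))
  ... | false with D (suc k) j in tile
  ...   | true =
    let j<n = ≤-trans (s≤s (m≤n+m j k)) (crossing-bound k j tile) in
    advance (step-cross-left k j (<⇒≤ j<n) tile)
            (trace-spec f (suc k) (suc j) fromLeft z<s (subst (_≤ n) (sym (+-suc k j)) (crossing-bound k j tile))
                        (fuel-right k j f j<n fuel))
  ...   | false =
    advance (step-elbow-left k j 1≤j (≤-trans (m≤n+m j k) ℓ≤n) tile)
            (trace-spec f k j fromBottom 1≤j (bottom-bound k j ℓ≤n) (≤-pred fuel))
  trace-spec (suc f) (suc k) j fromBottom 1≤j ℓ≤n fuel with n <ᵇ j in off-grid
  ... | true = ⊥-elim (<⇒≱ (<ᵇ-true⁻ off-grid) (≤-trans (≤-trans (m≤n+m j k) (n≤1+n _)) ℓ≤n))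
  ... | false with D (suc k) j in tile
  ...   | true =
    advance (step-cross-bottom k j 1≤j (≤-trans (m≤n+m j k) (<⇒≤ ℓ≤n)) tile)
            (trace-spec f k j fromBottom 1≤j (bottom-bound k j (<⇒≤ ℓ≤n)) (≤-pred fuel))
  ...   | false =
    advance (step-elbow-bottom k j (≤-trans (m≤n+m j k) (<⇒≤ ℓ≤n)) tile)
            (trace-spec f (suc k) (suc j) fromLeft z<s (subst (_≤ n) (sym (+-suc k j)) ℓ≤n)
                        (fuel-right k j f (≤-trans (s≤s (m≤n+m j k)) ℓ≤n) fuel))

  traced-resp : ∀ {t bs x cs y} → SameRun bs x cs y → Traced t cs y → Traced t bs x
  traced-resp (t≡ , v≡) (exit , seen) = trans exit (cong just (sym t≡)) , ⊆-trans (⊆-reflexive v≡) seen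

  crosses : List (ℕ × ℕ)
  crosses = crossesUpTo n

  rows-above-far : ∀ m p → p ≤ m → SameRun (crossesUpTo m) p (crossesUpTo p) p
  rows-above-far zero    zero z≤n = refl , refl
  rows-above-far (suc m) p  p≤1+m with m≤n⇒m<n∨m≡n p≤1+m
  ... | inj₂ refl = refl , refl
  ... | inj₁ p<1+m =
    SameRun-trans (skip-far (rowCrosses (suc m) 1 n) (crossesUpTo m) p
                            (rowCrosses-far-below m 1 n p (subst (p <_) (+-comm 1 m) p<1+m)))
                  (rows-above-far m p (≤-pred p<1+m))

  pipe-spec : ∀ p → 1 ≤ p → p ≤ n → Traced (pipe n D p) crosses p
  pipe-spec (suc p) _ p<n =
    traced-resp (rows-above-far n (suc p) p<n)
      (subst (Traced (pipe n D (suc p)) (crossesUpTo (suc p))) (+-comm p 1)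
        (trace-spec (suc (suc (n + n))) (suc p) 1 fromLeft z<s (subst (_≤ n) (+-comm 1 p) p<n)
                    (s≤s (s≤s (+-mono-≤ (≤-trans (n≤1+n p) p<n) (m∸n≤m n 1))))))

  rowCrosses-letters : ∀ k → map letter (rowCrosses (suc k) 1 n) ≡ φBlock n D k
  rowCrosses-letters k =
    trans (sym (map-∘ (filterᵇ (D (suc k)) (range 1 n))))
          (cong (map (λ j → suc k + j ∸ 1)) (sym (rowCols≡filter-range n D (suc k))))

  crossesUpTo-word : ∀ m → map letter (crossesUpTo m) ≡ factWord (applyUpTo (φBlock n D) m)
  crossesUpTo-word zero    = refl
  crossesUpTo-word (suc m) = begin
    map letter (rowCrosses (suc m) 1 n ++ crossesUpTo m)
      ≡⟨ map-++ letter (rowCrosses (suc m) 1 n) (crossesUpTo m) ⟩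
    map letter (rowCrosses (suc m) 1 n) ++ map letter (crossesUpTo m)
      ≡⟨ cong₂ _++_ (rowCrosses-letters m) (crossesUpTo-word m) ⟩
    φBlock n D m ++ factWord (applyUpTo (φBlock n D) m)
      ≡⟨ cong concat (sym (reverse-++ (applyUpTo (φBlock n D) m) [ φBlock n D m ])) ⟩
    factWord (applyUpTo (φBlock n D) m ++ [ φBlock n D m ])
      ≡⟨ cong factWord (applyUpTo-∷ʳ (φBlock n D) m) ⟩
    factWord (applyUpTo (φBlock n D) (suc m)) ∎
    where open ≡-Reasoning

  no-cross-below : ∀ r c → 1 ≤ c → n ≤ r → D r c ≡ false
  no-cross-below r c 1≤c n≤r with D r c in cross
  ... | false = refl
  ... | true  = ⊥-elim (<-irrefl refl (<-≤-trans (m<m+n r 1≤c) (≤-trans (proj₂ (proj₂ (allowed r c cross))) n≤r)))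

  cross∈rowCols : ∀ {r c} → D r c ≡ true → c ∈ rowCols n D r
  cross∈rowCols {r} {c} cross with allowed r c cross
  ... | _ , 1≤c , bound = subst (c ∈_) (sym (rowCols≡filter-range n D r))
    (∈-filter⁺ (T? ∘ D r) (∈-range⁺ 1 n 1≤c (s≤s (≤-trans (m≤n+m c r) bound))) (subst T (sym cross) _))

  rowCols⇒cross : ∀ {r c} → c ∈ rowCols n D r → D r c ≡ true
  rowCols⇒cross {r} c∈ = Equivalence.to T-≡ (proj₂ (∈-filter⁻ (T? ∘ D r) {xs = applyUpTo suc n} c∈))

  rowCols-beyond : ∀ r → n ≤ r → rowCols n D r ≡ []
  rowCols-beyond r n≤r =
    trans (rowCols≡filter-range n D r)
          (filter-none (T? ∘ D r) (All.map (λ b → subst T (no-cross-below r _ (proj₁ b) n≤r)) (range-bounds 1 n)))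

  empty-row : ∀ r → n ≤ r → rowCrosses r 1 n ≡ []
  empty-row r n≤r = cong (map (r ,_)) (trans (sym (rowCols≡filter-range n D r)) (rowCols-beyond r n≤r))

  factWord-φ : factWord (φ n D) ≡ map letter crosses
  factWord-φ = sym (word-of-rows n refl)
    where
    word-of-rows : ∀ m → m ≡ n → map letter (crossesUpTo m) ≡ factWord (applyUpTo (φBlock n D) (m ∸ 1))
    word-of-rows zero    _   = refl
    word-of-rows (suc m) 1+m≡n =
      trans (cong (λ bs → map letter (bs ++ crossesUpTo m)) (empty-row (suc m) (≤-reflexive (sym 1+m≡n))))
            (crossesUpTo-word m)

  IsCross : ℕ × ℕ → Set
  IsCross b = D (proj₁ b) (proj₂ b) ≡ true

  crossesUpTo-crosses : ∀ k → All IsCross (crossesUpTo k)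
  crossesUpTo-crosses zero    = []
  crossesUpTo-crosses (suc k) =
    AllP.++⁺ (AllP.map⁺ (All.map (Equivalence.to T-≡) (AllP.all-filter (T? ∘ D (suc k)) (range 1 n))))
             (crossesUpTo-crosses k)

  cross-letter-valid : ∀ b → IsCross b → ValidLetter n (letter b)
  cross-letter-valid (r , c) cross with allowed r c cross
  cross-letter-valid (suc r , suc c) cross | _ , _ , bound = ≤-trans (s≤s z≤n) (m≤n+m (suc c) r) , bound

  crosses-valid : All (ValidLetter n) (map letter crosses)
  crosses-valid = AllP.map⁺ (All.map (λ {b} → cross-letter-valid b) (crossesUpTo-crosses n))

  crossesUpTo-rows : ∀ k → All (λ b → proj₁ b ≤ k) (crossesUpTo k)
  crossesUpTo-rows zero    = []
  crossesUpTo-rows (suc k) =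
    AllP.++⁺ (AllP.map⁺ (All.tabulate (λ _ → ≤-refl))) (All.map (λ b≤k → ≤-trans b≤k (n≤1+n k)) (crossesUpTo-rows k))

  crossesUpTo-distinct : ∀ k → AllPairs _≢_ (crossesUpTo k)
  crossesUpTo-distinct zero    = []
  crossesUpTo-distinct (suc k) =
    APP.++⁺ (APP.map⁺ (APP.filter⁺ (T? ∘ D (suc k)) (AllPairs.map (λ c<c′ e → <-irrefl (cong proj₂ e) c<c′) (range-increasing 1 n))))
            (crossesUpTo-distinct k)
            (AllP.map⁺ (All.tabulate (λ _ → All.map (λ b≤k e → <-irrefl (sym (cong proj₁ e)) (s≤s b≤k)) (crossesUpTo-rows k))))

count : (ℕ → Bool) → List ℕ → ℕ
count p xs = length (filterᵇ p xs)

inversions : List ℕ → ℕ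
inversions []       = 0
inversions (x ∷ xs) = count (_<ᵇ x) xs + inversions xs

count-∷ : ∀ p x xs → count p (x ∷ xs) ≡ (if p x then suc (count p xs) else count p xs)
count-∷ p x xs with p x
... | true  = refl
... | false = refl

count-swap : ∀ p pre x y post → count p (pre ++ x ∷ y ∷ post) ≡ count p (pre ++ y ∷ x ∷ post)
count-swap p [] x y post
  rewrite count-∷ p x (y ∷ post) | count-∷ p y (x ∷ post) | count-∷ p x post | count-∷ p y post
  with p x | p y
... | true  | true  = refl
... | true  | false = refl
... | false | true  = refl
... | false | false = refl
count-swap p (z ∷ pre) x y post
  rewrite count-∷ p z (pre ++ x ∷ y ∷ post) | count-∷ p z (pre ++ y ∷ x ∷ post) with p z
... | true  = cong suc (count-swap p pre x y post)
... | false = count-swap p pre x y post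

inversions-swap-< : ∀ pre x y post → x < y → inversions (pre ++ y ∷ x ∷ post) ≡ suc (inversions (pre ++ x ∷ y ∷ post))
inversions-swap-< [] x y post x<y
  rewrite count-∷ (_<ᵇ y) x post | count-∷ (_<ᵇ x) y post | <ᵇ-true x<y | <ᵇ-false {y} {x} (<⇒≤ x<y) =
  cong suc (+-swap-assoc (count (_<ᵇ y) post) (count (_<ᵇ x) post) (inversions post))
  where
  +-swap-assoc : ∀ a b c → a + (b + c) ≡ b + (a + c)
  +-swap-assoc a b c = trans (sym (+-assoc a b c)) (trans (cong (_+ c) (+-comm a b)) (+-assoc b a c))
inversions-swap-< (z ∷ pre) x y post x<y =
  trans (cong₂ _+_ (count-swap (_<ᵇ z) pre y x post) (inversions-swap-< pre x y post x<y))
        (+-suc (count (_<ᵇ z) (pre ++ x ∷ y ∷ post)) _)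

inversions-swap-≤ : ∀ pre x y post → inversions (pre ++ y ∷ x ∷ post) ≤ suc (inversions (pre ++ x ∷ y ∷ post))
inversions-swap-≤ pre x y post with <-cmp x y
... | tri< x<y _ _ = ≤-reflexive (inversions-swap-< pre x y post x<y)
... | tri≈ _ refl _ = n≤1+n _
... | tri> _ _ y<x = ≤-trans (n≤1+n _) (≤-trans (≤-reflexive (sym (inversions-swap-< pre y x post y<x))) (n≤1+n _))

map-far : ∀ (f : ℕ → ℕ) a xs → All (Far a) xs → map (f ∘ sAct a) xs ≡ map f xs
map-far f a []       []           = refl
map-far f a (x ∷ xs) (far ∷ fars) = cong₂ _∷_ (cong f (sAct-far a x far)) (map-far f a xs fars)

module OneLine (n : ℕ) where

  oneLine : (ℕ → ℕ) → List ℕ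
  oneLine f = map f (range 1 n)

  private
    module AroundLetter (a : ℕ) (a+1<n : suc (suc a) ≤ n) where

      t : ℕ
      t = n ∸ suc (suc a)

      split-range : range 1 n ≡ range 1 a ++ suc a ∷ suc (suc a) ∷ range (suc (suc (suc a))) t
      split-range =
        trans (cong (range 1) (trans (sym (m+[n∸m]≡n a+1<n)) (sym (trans (+-suc a (suc t)) (cong suc (+-suc a t))))))
              (range-++ 1 a (suc (suc t)))

      before after : List ℕ
      before = range 1 a
      after  = range (suc (suc (suc a))) t

      split-oneLine : ∀ f → oneLine f ≡ map f before ++ f (suc a) ∷ f (suc (suc a)) ∷ map f after
      split-oneLine f = trans (cong (map f) split-range) (map-++ f before _)

      split-oneLine-sAct : ∀ f → oneLine (f ∘ sAct (suc a)) ≡ map f before ++ f (suc (suc a)) ∷ f (suc a) ∷ map f after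
      split-oneLine-sAct f =
        trans (trans (cong (map (f ∘ sAct (suc a))) split-range) (map-++ (f ∘ sAct (suc a)) before _))
              (cong₂ _++_ (map-far f (suc a) before (All.map (inj₁ ∘ proj₂) (range-bounds 1 a)))
                 (cong₂ _∷_ (cong f (sAct-at (suc a)))
                   (cong₂ _∷_ (cong f (sAct-next (suc a)))
                     (map-far f (suc a) after (All.map (inj₂ ∘ proj₁) (range-bounds (suc (suc (suc a))) t))))))

  inversions-letter-< : ∀ a → ValidLetter n a → ∀ f → f a < f (suc a) →
    inversions (oneLine (f ∘ sAct a)) ≡ suc (inversions (oneLine f))
  inversions-letter-< (suc a) (_ , a<n) f asc
    rewrite AroundLetter.split-oneLine-sAct a a<n f | AroundLetter.split-oneLine a a<n f =
    inversions-swap-< (map f (AroundLetter.before a a<n)) (f (suc a)) (f (suc (suc a))) (map f (AroundLetter.after a a<n)) asc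

  inversions-letter-≤ : ∀ a → ValidLetter n a → ∀ f → inversions (oneLine (f ∘ sAct a)) ≤ suc (inversions (oneLine f))
  inversions-letter-≤ (suc a) (_ , a<n) f
    rewrite AroundLetter.split-oneLine-sAct a a<n f | AroundLetter.split-oneLine a a<n f =
    inversions-swap-≤ (map f (AroundLetter.before a a<n)) (f (suc a)) (f (suc (suc a))) (map f (AroundLetter.after a a<n))

  inversions-word-≤ : ∀ ws f → All (ValidLetter n) ws →
    inversions (oneLine (f ∘ wordAct ws)) ≤ length ws + inversions (oneLine f)
  inversions-word-≤ []       f []       = ≤-refl
  inversions-word-≤ (a ∷ ws) f (v ∷ vs) = begin
    inversions (oneLine (f ∘ wordAct (a ∷ ws)))       ≤⟨ inversions-word-≤ ws (f ∘ sAct a) vs ⟩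
    length ws + inversions (oneLine (f ∘ sAct a))    ≤⟨ +-monoʳ-≤ (length ws) (inversions-letter-≤ a v f) ⟩
    length ws + suc (inversions (oneLine f))         ≡⟨ +-suc (length ws) _ ⟩
    length (a ∷ ws) + inversions (oneLine f)         ∎
    where open ≤-Reasoning

  Ascending : List ℕ → List ℕ → Set
  Ascending pre []       = ⊤
  Ascending pre (a ∷ as) = wordAct pre a < wordAct pre (suc a) × Ascending (pre ++ [ a ]) as

  inversions-ascending : ∀ pre as → All (ValidLetter n) as → Ascending pre as →
    inversions (oneLine (wordAct (pre ++ as))) ≡ length as + inversions (oneLine (wordAct pre))
  inversions-ascending pre []       []       _ =
    cong (λ ws → inversions (oneLine (wordAct ws))) (++-identityʳ pre)
  inversions-ascending pre (a ∷ as) (v ∷ vs) (asc , rest) = begin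
    inversions (oneLine (wordAct (pre ++ a ∷ as)))
      ≡⟨ cong (λ ws → inversions (oneLine (wordAct ws))) (sym (++-assoc pre [ a ] as)) ⟩
    inversions (oneLine (wordAct ((pre ++ [ a ]) ++ as)))
      ≡⟨ inversions-ascending (pre ++ [ a ]) as vs rest ⟩
    length as + inversions (oneLine (wordAct (pre ++ [ a ])))
      ≡⟨ cong (λ m → length as + inversions m) (map-cong (λ x → wordAct-++ pre [ a ] x) (range 1 n)) ⟩
    length as + inversions (oneLine (wordAct pre ∘ sAct a))
      ≡⟨ cong (length as +_) (inversions-letter-< a v (wordAct pre) asc) ⟩
    length as + suc (inversions (oneLine (wordAct pre)))
      ≡⟨ +-suc (length as) _ ⟩
    length (a ∷ as) + inversions (oneLine (wordAct pre)) ∎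
    where open ≡-Reasoning

  inversions-identity : inversions (oneLine (λ x → x)) ≡ 0
  inversions-identity = trans (cong inversions (map-id (range 1 n))) (increasing-inversions 1 n)
    where
    increasing-inversions : ∀ j m → inversions (range j m) ≡ 0
    increasing-inversions j zero    = refl
    increasing-inversions j (suc m) =
      cong₂ _+_ (cong length (filter-none (T? ∘ (_<ᵇ j)) (All.map (λ b → subst T (<ᵇ-false (<⇒≤ (proj₁ b)))) (range-bounds (suc j) m))))
                (increasing-inversions (suc j) m)

length-filter-concat : ∀ {A B : Set} (p : B → Bool) (F : A → List B) xs →
  length (filterᵇ p (concat (map F xs))) ≡ sum (map (λ x → length (filterᵇ p (F x))) xs)
length-filter-concat p F []       = refl
length-filter-concat p F (x ∷ xs) =
  trans (cong length (filter-++ (T? ∘ p) (F x) (concat (map F xs))))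
        (trans (length-++ (filterᵇ p (F x))) (cong (length (filterᵇ p (F x)) +_) (length-filter-concat p F xs)))

length-filter-map : ∀ {A B : Set} (p : B → Bool) (f : A → B) xs →
  length (filterᵇ p (map f xs)) ≡ length (filterᵇ (p ∘ f) xs)
length-filter-map p f []       = refl
length-filter-map p f (x ∷ xs) with p (f x)
... | true  = cong suc (length-filter-map p f xs)
... | false = length-filter-map p f xs

allFin-suc : ∀ n → allFin (suc n) ≡ fzero ∷ map fsuc (allFin n)
allFin-suc n = cong (fzero ∷_) (sym (map-tabulate id fsuc))

map-allFin≡range : ∀ n j → map (λ y → j + toℕ y) (allFin n) ≡ range j n
map-allFin≡range zero    j = refl
map-allFin≡range (suc n) j =
  trans (cong (map (λ y → j + toℕ y)) (allFin-suc n))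
        (cong₂ _∷_ (+-identityʳ j) (trans (sym (map-∘ (allFin n)))
          (trans (map-cong (λ y → +-suc j (toℕ y)) (allFin n)) (map-allFin≡range n (suc j)))))

module _ (n : ℕ) (g : Fin n → ℕ) where

  invertedAfter : Fin n → ℕ
  invertedAfter x = length (filterᵇ (λ y → (toℕ x <ᵇ toℕ y) ∧ (g y <ᵇ g x)) (allFin n))

  invertedPairs≡sum : length (filterᵇ (λ xy → (toℕ (proj₁ xy) <ᵇ toℕ (proj₂ xy)) ∧ (g (proj₂ xy) <ᵇ g (proj₁ xy)))
                                     (concat (map (λ x → map (x ,_) (allFin n)) (allFin n))))
                      ≡ sum (map invertedAfter (allFin n))
  invertedPairs≡sum =
    trans (length-filter-concat _ (λ x → map (x ,_) (allFin n)) (allFin n))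
          (cong sum (map-cong (λ x → length-filter-map _ (x ,_) (allFin n)) (allFin n)))

sum-invertedAfter : ∀ n g → sum (map (invertedAfter n g) (allFin n)) ≡ inversions (map g (allFin n))
sum-invertedAfter zero    g = refl
sum-invertedAfter (suc n) g = begin
  sum (map (invertedAfter (suc n) g) (allFin (suc n)))
    ≡⟨ cong (λ xs → sum (map (λ x → length (filterᵇ (λ y → (toℕ x <ᵇ toℕ y) ∧ (g y <ᵇ g x)) xs)) xs)) (allFin-suc n) ⟩
  after fzero + sum (map after (map fsuc (allFin n)))
    ≡⟨ cong₂ _+_ (trans (length-filter-map _ fsuc (allFin n)) (sym (length-filter-map _ (g ∘ fsuc) (allFin n))))
                 (trans (cong sum (sym (map-∘ (allFin n))))
                        (trans (cong sum (map-cong (λ x → length-filter-map _ fsuc (allFin n)) (allFin n)))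
                               (sum-invertedAfter n (g ∘ fsuc)))) ⟩
  count (_<ᵇ g fzero) (map (g ∘ fsuc) (allFin n)) + inversions (map (g ∘ fsuc) (allFin n))
    ≡⟨ cong (λ xs → count (_<ᵇ g fzero) xs + inversions xs) (map-∘ (allFin n)) ⟩
  inversions (map g (fzero ∷ map fsuc (allFin n)))
    ≡⟨ cong (inversions ∘ map g) (sym (allFin-suc n)) ⟩
  inversions (map g (allFin (suc n))) ∎
  where
  open ≡-Reasoning
  after : Fin (suc n) → ℕ
  after x = length (filterᵇ (λ y → (toℕ x <ᵇ toℕ y) ∧ (g y <ᵇ g x)) (fzero ∷ map fsuc (allFin n)))

invCount≡inversions : ∀ n v → invCount n v ≡ inversions (map (val v) (allFin n))
invCount≡inversions n v = trans (invertedPairs≡sum n (val v)) (sum-invertedAfter n (val v))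

-- The reading word of a reduced pipe dream

InRange : ℕ → ℕ → Set
InRange n x = 1 ≤ x × x ≤ n

sAct-inRange : ∀ {n a x} → ValidLetter n a → InRange n x → InRange n (sAct a x)
sAct-inRange {a = a} {x} (1≤a , a<n) (1≤x , x≤n) with moved-or-far a x
... | inj₁ (inj₁ refl) rewrite sAct-at x = s≤s z≤n , a<n
... | inj₁ (inj₂ refl) rewrite sAct-next a = 1≤a , ≤-trans (n≤1+n a) x≤n
... | inj₂ far rewrite sAct-far a x far = 1≤x , x≤n

wordAct-inRange : ∀ {n} ws {x} → All (ValidLetter n) ws → InRange n x → InRange n (wordAct ws x)
wordAct-inRange []       []       x∈ = x∈
wordAct-inRange (a ∷ ws) (v ∷ vs) x∈ = sAct-inRange v (wordAct-inRange ws vs x∈)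

distinct⇒∉-prefix : ∀ {A : Set} (xs : List A) {y ys} → AllPairs _≢_ (xs ++ y ∷ ys) → y ∉ xs
distinct⇒∉-prefix (x ∷ xs) (x≢ ∷ _) (here refl) = All.lookup x≢ (∈-++⁺ʳ xs (here refl)) refl
distinct⇒∉-prefix (x ∷ xs) (_ ∷ d)  (there y∈) = distinct⇒∉-prefix xs d y∈

module ReducedPipeDream (n : ℕ) (w : Permutation′ n) (D : PipeDream) (rp : RP n w D) where

  open PipeTracing n D (proj₁ (proj₁ rp)) public
  open OneLine n public

  word : List ℕ
  word = map letter crosses

  private
    visits-on-pipe : ∀ {p} (p<n : p < n) → visits crosses (suc p) ⊆ proj₁ (pipe n D (suc (toℕ (fromℕ< p<n))))
    visits-on-pipe {p} p<n rewrite toℕ-fromℕ< p<n = Traced.on-pipe (pipe-spec (suc p) z<s p<n)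

  pipes-cross-once : ∀ {p q} → InRange n p → InRange n q → p ≢ q → ∀ {c c′} → IsCross c → IsCross c′ →
    c ∈ visits crosses p → c ∈ visits crosses q → c′ ∈ visits crosses p → c′ ∈ visits crosses q → c ≡ c′
  pipes-cross-once {suc p} {suc q} (_ , p<n) (_ , q<n) p≢q {c} {c′} cross cross′ cp cq c′p c′q =
    proj₂ rp (fromℕ< p<n) (fromℕ< q<n) distinct c c′ cross cross′
      (visits-on-pipe p<n cp) (visits-on-pipe q<n cq) (visits-on-pipe p<n c′p) (visits-on-pipe q<n c′q)
    where
    distinct : fromℕ< p<n ≢ fromℕ< q<n
    distinct e = p≢q (cong suc (trans (sym (toℕ-fromℕ< p<n)) (trans (cong toℕ e) (toℕ-fromℕ< q<n))))

  private
    module AtCrossing {mid c post} (split : crosses ≡ mid ++ c ∷ post) where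

      a p q : ℕ
      a = letter c
      p = wordAct (map letter mid) a
      q = wordAct (map letter mid) (suc a)

      all-crosses : All IsCross (mid ++ c ∷ post)
      all-crosses = subst (All IsCross) split (crossesUpTo-crosses n)

      cross-c : IsCross c
      cross-c = All.lookup all-crosses (∈-++⁺ʳ mid (here refl))

      mid-valid : All (ValidLetter n) (map letter mid)
      mid-valid = AllP.map⁺ (All.map (λ {b} → cross-letter-valid b) (AllP.++⁻ˡ mid all-crosses))

      p-inRange : InRange n p
      p-inRange = wordAct-inRange (map letter mid) mid-valid (proj₁ (cross-letter-valid c cross-c) , <⇒≤ (proj₂ (cross-letter-valid c cross-c)))

      q-inRange : InRange n q
      q-inRange = wordAct-inRange (map letter mid) mid-valid (s≤s z≤n , proj₂ (cross-letter-valid c cross-c))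

      track-p : track mid p ≡ a
      track-p = track-wordAct mid a

      track-q : track mid q ≡ suc a
      track-q = track-wordAct mid (suc a)

      visits-split : ∀ x → visits crosses x ≡ visits mid x ++ visits (c ∷ post) (track mid x)
      visits-split x = trans (cong (λ bs → visits bs x) split) (visits-++ mid (c ∷ post) x)

      c-visited : ∀ {x} → Moved a (track mid x) → c ∈ visits crosses x
      c-visited {x} moved = subst (c ∈_) (sym (visits-split x))
        (∈-++⁺ʳ (visits mid x) (subst (c ∈_) (sym (visits-moved c post (track mid x) moved)) (here refl)))

      earlier-visited : ∀ {c′ x} → c′ ∈ visits mid x → c′ ∈ visits crosses x
      earlier-visited {c′} {x} c′∈ = subst (c′ ∈_) (sym (visits-split x)) (∈-++⁺ˡ c′∈)

      -- The labels a and a + 1 meet at the crossing c; had they been inverted before it, they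
      -- would already have met at an earlier crossing c′, so two pipes would cross twice.
      not-inverted : ¬ q < p
      not-inverted q<p with inversion-meets mid q<p (subst₂ _<_ (sym track-p) (sym track-q) (n<1+n a))
      ... | c′ , c′q , c′p =
        distinct⇒∉-prefix mid (subst (AllPairs _≢_) split (crossesUpTo-distinct n)) (subst (_∈ mid) (sym c≡c′) c′∈mid)
        where
        c′∈mid : c′ ∈ mid
        c′∈mid = visits-⊆ mid q c′q
        c≡c′ : c ≡ c′
        c≡c′ = pipes-cross-once p-inRange q-inRange (λ p≡q → <-irrefl (sym p≡q) q<p) cross-c (All.lookup all-crosses (∈-++⁺ˡ c′∈mid))
                 (c-visited (subst (Moved a) (sym track-p) (inj₁ refl))) (c-visited (subst (Moved a) (sym track-q) (inj₂ refl)))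
                 (earlier-visited c′p) (earlier-visited c′q)

  crossing-ascent : ∀ mid c post → crosses ≡ mid ++ c ∷ post →
    wordAct (map letter mid) (letter c) < wordAct (map letter mid) (suc (letter c))
  crossing-ascent mid c post split =
    ≤∧≢⇒< (≮⇒≥ not-inverted) (λ p≡q → 1+n≢n (sym (trans (sym track-p) (trans (cong (track mid) p≡q) track-q))))
    where open AtCrossing split

  ascending-from-splits : ∀ pre bs →
    (∀ mid b post → bs ≡ mid ++ b ∷ post →
       wordAct (map letter (pre ++ mid)) (letter b) < wordAct (map letter (pre ++ mid)) (suc (letter b))) →
    Ascending (map letter pre) (map letter bs)
  ascending-from-splits pre []       _      = _
  ascending-from-splits pre (b ∷ bs) ascent =
    subst (λ ws → wordAct ws (letter b) < wordAct ws (suc (letter b))) (cong (map letter) (++-identityʳ pre)) (ascent [] b bs refl) ,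
    subst (λ ws → Ascending ws (map letter bs)) (map-++ letter pre [ b ])
      (ascending-from-splits (pre ++ [ b ]) bs λ mid b′ post split →
        subst (λ bs → wordAct (map letter bs) (letter b′) < wordAct (map letter bs) (suc (letter b′)))
              (sym (++-assoc pre [ b ] mid)) (ascent (b ∷ mid) b′ post (cong (b ∷_) split)))

  inversions-word : inversions (oneLine (wordAct word)) ≡ length word
  inversions-word = begin
    inversions (oneLine (wordAct word))
      ≡⟨ inversions-ascending [] word crosses-valid (ascending-from-splits [] crosses crossing-ascent) ⟩
    length word + inversions (oneLine (λ x → x))
      ≡⟨ cong (length word +_) inversions-identity ⟩
    length word + 0
      ≡⟨ +-identityʳ _ ⟩
    length word ∎
    where open ≡-Reasoning

  track-exit : ∀ (x : Fin n) → track crosses (suc (toℕ x)) ≡ val w x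
  track-exit x = just-injective (trans (sym (Traced.exit (pipe-spec (suc (toℕ x)) z<s (toℕ<n x)))) (proj₂ (proj₁ rp) x))

  word-represents-inverse : ∀ (y : Fin n) → wordAct word (suc (toℕ y)) ≡ val (flip w) y
  word-represents-inverse y =
    trans (cong (wordAct word) (sym (trans (track-exit (w ⟨$⟩ˡ y)) (cong (suc ∘ toℕ) (inverseʳ w)))))
          (wordAct-track crosses (suc (toℕ (w ⟨$⟩ˡ y))))

  length-word : length word ≡ invCount n (flip w)
  length-word = sym (begin
    invCount n (flip w)                                        ≡⟨ invCount≡inversions n (flip w) ⟩
    inversions (map (val (flip w)) (allFin n))                 ≡⟨ cong inversions (sym (map-cong word-represents-inverse (allFin n))) ⟩
    inversions (map (wordAct word ∘ suc ∘ toℕ) (allFin n))     ≡⟨ cong inversions (map-∘ (allFin n)) ⟩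
    inversions (map (wordAct word) (map (suc ∘ toℕ) (allFin n))) ≡⟨ cong (inversions ∘ map (wordAct word)) (map-allFin≡range n 1) ⟩
    inversions (oneLine (wordAct word))                        ≡⟨ inversions-word ⟩
    length word                                                ∎)
    where open ≡-Reasoning

  word-minimal : ∀ ws → (∀ x → wordAct word x ≡ wordAct ws x) → All (ValidLetter n) ws → ¬ length ws < length word
  word-minimal ws same valid shorter = <-irrefl refl (begin-strict
    length ws                                          <⟨ shorter ⟩
    length word                                        ≡⟨ sym inversions-word ⟩
    inversions (oneLine (wordAct word))                ≡⟨ cong inversions (map-cong same (range 1 n)) ⟩
    inversions (oneLine (wordAct ws))                  ≤⟨ inversions-word-≤ ws (λ x → x) valid ⟩
    length ws + inversions (oneLine (λ x → x))         ≡⟨ cong (length ws +_) inversions-identity ⟩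
    length ws + 0                                      ≡⟨ +-identityʳ _ ⟩
    length ws                                          ∎)
    where open ≤-Reasoning

-- The pairing

increasing-head : ∀ {h t y} → Increasing (h ∷ t) → y ∈ h ∷ t → h ≤ y
increasing-head _           (here refl) = ≤-refl
increasing-head (h<t ∷ _)  (there y∈)  = <⇒≤ (All.lookup h<t y∈)

reverse-decreasing : ∀ xs → Increasing xs → AllPairs (λ x y → y < x) (reverse xs)
reverse-decreasing []       []          = []
reverse-decreasing (x ∷ xs) (x<xs ∷ inc) =
  subst (AllPairs _) (sym (unfold-reverse x xs))
    (APP.++⁺ (reverse-decreasing xs inc) (All.[] ∷ [])
             (All.tabulate (λ y∈ → All.lookup x<xs (reverse⁻ y∈) ∷ [])))

removeFirst-⊆ : ∀ p xs → removeFirst p xs ⊆ xs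
removeFirst-⊆ p (h ∷ t) y∈ with p h
... | true = there y∈
removeFirst-⊆ p (h ∷ t) (here e)  | false = here e
removeFirst-⊆ p (h ∷ t) (there y∈) | false = there (removeFirst-⊆ p t y∈)

removeFirst-keeps : ∀ p {xs y} → p y ≡ false → y ∈ xs → y ∈ removeFirst p xs
removeFirst-keeps p {h ∷ t} py (here refl) rewrite py = here refl
removeFirst-keeps p {h ∷ t} py (there y∈) with p h
... | true  = y∈
... | false = there (removeFirst-keeps p py y∈)

removeFirst-increasing : ∀ p xs → Increasing xs → Increasing (removeFirst p xs)
removeFirst-increasing p []      inc = inc
removeFirst-increasing p (h ∷ t) (h<t ∷ inc) with p h
... | true  = inc
... | false = AllP.anti-mono (removeFirst-⊆ p t) h<t ∷ removeFirst-increasing p t inc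

removeFirst-keeps-above : ∀ a {xs v e} → Increasing xs → v ∈ xs → a < v → e ∈ xs → v < e → e ∈ removeFirst (a <ᵇ_) xs
removeFirst-keeps-above a {h ∷ t} inc v∈ a<v e∈ v<e with a <ᵇ h in a<h
removeFirst-keeps-above a {h ∷ t} inc       v∈ a<v (here refl) v<e | true  = ⊥-elim (<⇒≱ v<e (increasing-head inc v∈))
removeFirst-keeps-above a {h ∷ t} inc       v∈ a<v (there e∈)  v<e | true  = e∈
removeFirst-keeps-above a {h ∷ t} inc       v∈ a<v (here refl) v<e | false = here refl
removeFirst-keeps-above a {h ∷ t} (_ ∷ inc) (here refl) a<v (there e∈) v<e | false = ⊥-elim (<⇒≱ a<v (<ᵇ-false⁻ a<h))
removeFirst-keeps-above a {h ∷ t} (_ ∷ inc) (there v∈)  a<v (there e∈) v<e | false =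
  there (removeFirst-keeps-above a inc v∈ a<v e∈ v<e)

removeFirst-keeps-unless-successor : ∀ a {xs e} → Increasing xs → suc a ∈ xs → e ∈ xs → e ≢ suc a → e ∈ removeFirst (a <ᵇ_) xs
removeFirst-keeps-unless-successor a {e = e} inc sa∈ e∈ e≢ with <-cmp a e
... | tri< a<e _ _ = removeFirst-keeps-above a inc sa∈ (n<1+n a) e∈ (≤∧≢⇒< a<e (e≢ ∘ sym))
... | tri≈ _ refl _ = removeFirst-keeps (a <ᵇ_) (<ᵇ-false {a} {a} ≤-refl) e∈
... | tri> _ _ e<a = removeFirst-keeps (a <ᵇ_) (<ᵇ-false (<⇒≤ e<a)) e∈

removeFirst-removes-successor : ∀ a {xs} → Increasing xs → suc a ∈ xs → suc a ∉ removeFirst (a <ᵇ_) xs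
removeFirst-removes-successor a {h ∷ t} (h<t ∷ inc) sa∈ with a <ᵇ h in a<h | sa∈
... | true  | here refl = λ sa∈t → <-irrefl refl (All.lookup h<t sa∈t)
... | true  | there sa∈t = ⊥-elim (<-irrefl refl (<-≤-trans (<ᵇ-true⁻ a<h) (≤-pred (All.lookup h<t sa∈t))))
... | false | here refl = ⊥-elim (<-irrefl refl (<ᵇ-false⁻ {a} {suc a} a<h))
... | false | there sa∈t = λ { (here sa≡h) → <-irrefl (sym sa≡h) (s≤s (<ᵇ-false⁻ a<h))
                          ; (there sa∈′) → removeFirst-removes-successor a inc sa∈t sa∈′ }

unpaired-⊆ : ∀ X av → unpairedF X av ⊆ av
unpaired-⊆ []      av y∈ = y∈
unpaired-⊆ (a ∷ X) av y∈ = removeFirst-⊆ (a <ᵇ_) av (unpaired-⊆ X _ y∈)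

unpaired-not-successor : ∀ X av {v} → Increasing av → v ∈ unpairedF X av → ∀ {a} → a ∈ X → suc a ≢ v
unpaired-not-successor (a ∷ X) av inc v∈ (here refl) refl =
  removeFirst-removes-successor a inc (removeFirst-⊆ (a <ᵇ_) av (unpaired-⊆ X _ v∈)) (unpaired-⊆ X _ v∈)
unpaired-not-successor (a′ ∷ X) av inc v∈ (there a∈) = unpaired-not-successor X _ (removeFirst-increasing (a′ <ᵇ_) av inc) v∈ a∈

-- X lists the letters of r^i still to be processed, largest first, and av the letters of r^{i+1}
-- not yet paired: t + 1 survives a gap t ∉ r^i as long as whatever a later letter could claim
-- in [v, t] is still available.
module _ (v t : ℕ) (v≤t : v ≤ t) where

  Claimable : List ℕ → List ℕ → Set
  Claimable X av = ∀ z → v ≤ z → z ≤ t → Any (λ a → z ≤ suc a) X → z ∈ av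

  successor-stays-unpaired : ∀ X av → Increasing av → AllPairs (λ x y → y < x) X → v ∈ unpairedF X av →
    t ∉ X → suc t ∈ av → Claimable X av → suc t ∈ unpairedF X av
  successor-stays-unpaired []      av inc dec v∈ t∉ st∈ claimable = st∈
  successor-stays-unpaired (a ∷ X) av inc (a>X ∷ dec) v∈ t∉ st∈ claimable =
    successor-stays-unpaired X av′ (removeFirst-increasing (a <ᵇ_) av inc) dec v∈ (t∉ ∘ there) st∈′ claimable′
    where
    av′ : List ℕ
    av′ = removeFirst (a <ᵇ_) av

    below-a : ∀ {z} → Any (λ a′ → z ≤ suc a′) X → z ≤ a
    below-a claim with x<a , z≤x+1 ← All.lookupAny a>X claim = ≤-trans z≤x+1 x<a

    st∈′ : suc t ∈ av′
    st∈′ with <-cmp a t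
    ... | tri≈ _ a≡t _ = ⊥-elim (t∉ (here (sym a≡t)))
    ... | tri> _ _ t<a = removeFirst-keeps (a <ᵇ_) (<ᵇ-false t<a) st∈
    ... | tri< a<t _ _ with v ≤? a
    ...   | yes v≤a = removeFirst-keeps-unless-successor a inc
                        (claimable (suc a) (≤-trans v≤a (n≤1+n a)) a<t (here ≤-refl)) st∈ (λ e → <-irrefl (suc-injective (sym e)) a<t)
    ...   | no  v≰a = removeFirst-keeps-above a inc (unpaired-⊆ (a ∷ X) av v∈) (≰⇒> v≰a) st∈ (s≤s v≤t)

    claimable′ : Claimable X av′
    claimable′ z v≤z z≤t claim =
      removeFirst-keeps (a <ᵇ_) (<ᵇ-false (below-a claim)) (claimable z v≤z z≤t (here (≤-trans (below-a claim) (n≤1+n a))))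

maxOf-∈ : ∀ x xs → maxOf x xs ∈ x ∷ xs
maxOf-∈ x xs with foldr-selective ⊔-sel x xs
... | inj₁ max≡x = here max≡x
... | inj₂ max∈  = there max∈

maxOf-≥ : ∀ x xs {y} → y ∈ x ∷ xs → y ≤ maxOf x xs
maxOf-≥ x xs {y} y∈ = foldr-preservesᵒ (λ a b → [ m≤n⇒m≤n⊔o b , m≤n⇒m≤o⊔n a ]′) x xs (at y∈)
  where
  at : y ∈ x ∷ xs → y ≤ x ⊎ Any (y ≤_) xs
  at (here refl) = inj₁ ≤-refl
  at (there y∈′) = inj₂ (Any.map ≤-reflexive y∈′)

elemᵇ-true⁻ : ∀ x xs → elemᵇ x xs ≡ true → x ∈ xs
elemᵇ-true⁻ x (y ∷ ys) e with x ≡ᵇ y in x≡y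
... | true  = here (≡ᵇ-true⁻ x≡y)
... | false = there (elemᵇ-true⁻ x ys e)

elemᵇ-false⁻ : ∀ x xs → elemᵇ x xs ≡ false → x ∉ xs
elemᵇ-false⁻ x (y ∷ ys) e x∈ with x ≡ᵇ y in x≡y | x∈
... | true  | _          = case e of λ ()
... | false | here refl  = case trans (sym x≡y) (≡ᵇ-refl x) of λ ()
... | false | there x∈′  = elemᵇ-false⁻ x ys e x∈′

elemᵇ-true : ∀ {x xs} → x ∈ xs → elemᵇ x xs ≡ true
elemᵇ-true {x} {xs} x∈ with elemᵇ x xs in e
... | true  = refl
... | false = ⊥-elim (elemᵇ-false⁻ x xs e x∈)

elemᵇ-false : ∀ {x xs} → x ∉ xs → elemᵇ x xs ≡ false
elemᵇ-false {x} {xs} x∉ with elemᵇ x xs in e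
... | true  = ⊥-elim (x∉ (elemᵇ-true⁻ x xs e))
... | false = refl

count-mono : ∀ (p q : ℕ → Bool) xs → (∀ x → q x ≡ true → p x ≡ true) → count q xs ≤ count p xs
count-mono p q []       q⇒p = z≤n
count-mono p q (x ∷ xs) q⇒p rewrite count-∷ p x xs | count-∷ q x xs with q x in qx | p x in px
... | true  | true  = s≤s (count-mono p q xs q⇒p)
... | true  | false = case trans (sym (q⇒p x qx)) px of λ ()
... | false | true  = m≤n⇒m≤1+n (count-mono p q xs q⇒p)
... | false | false = count-mono p q xs q⇒p

count-above-suc : ∀ z xs → suc z ∈ xs → count (suc z <ᵇ_) xs < count (z <ᵇ_) xs
count-above-suc z (x ∷ xs) (here refl)
  rewrite count-∷ (z <ᵇ_) (suc z) xs | count-∷ (suc z <ᵇ_) (suc z) xs | <ᵇ-false {suc z} {suc z} ≤-refl | <ᵇ-true {z} {suc z} ≤-refl =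
  s≤s (count-mono (z <ᵇ_) (suc z <ᵇ_) xs λ y sz<y → <ᵇ-true {z} {y} (<-trans (n<1+n z) (<ᵇ-true⁻ {suc z} {y} sz<y)))
count-above-suc z (x ∷ xs) (there sz∈) rewrite count-∷ (z <ᵇ_) x xs | count-∷ (suc z <ᵇ_) x xs
  with suc z <ᵇ x in szx | z <ᵇ x in zx
... | true  | true  = s≤s (count-above-suc z xs sz∈)
... | true  | false = ⊥-elim (<⇒≱ (<ᵇ-true⁻ {suc z} {x} szx) (≤-trans (<ᵇ-false⁻ {z} {x} zx) (n≤1+n z)))
... | false | true  = m≤n⇒m≤1+n (count-above-suc z xs sz∈)
... | false | false = count-above-suc z xs sz∈

count-≤-length : ∀ p xs → count p xs ≤ length xs
count-≤-length p xs = length-filter (T? ∘ p) xs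

record GapAbove (xs : List ℕ) (z s : ℕ) : Set where
  field
    z≤s      : z ≤ s
    run      : ∀ t → z ≤ t → t ≤ s → t ∈ xs
    gap      : suc s ∉ xs

-- the fuel suffices because each step passes a further element of xs above z
nextGap-spec : ∀ xs f z → count (z <ᵇ_) xs < f → z ∈ xs → GapAbove xs z (nextGapF f xs z)
nextGap-spec xs (suc f) z fuel z∈ with elemᵇ (suc z) xs in next
... | false = record { z≤s = ≤-refl ; run = λ t z≤t t≤z → subst (_∈ xs) (≤-antisym z≤t t≤z) z∈ ; gap = elemᵇ-false⁻ (suc z) xs next }
... | true  = record { z≤s = ≤-trans (n≤1+n z) (GapAbove.z≤s rest) ; run = run ; gap = GapAbove.gap rest }
  where
  rest : GapAbove xs (suc z) (nextGapF f xs (suc z))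
  rest = nextGap-spec xs f (suc z) (≤-pred (<-≤-trans (s≤s (count-above-suc z xs (elemᵇ-true⁻ (suc z) xs next))) fuel))
                      (elemᵇ-true⁻ (suc z) xs next)
  run : ∀ t → z ≤ t → t ≤ nextGapF f xs (suc z) → t ∈ xs
  run t z≤t t≤s with m≤n⇒m<n∨m≡n z≤t
  ... | inj₂ refl = z∈
  ... | inj₁ z<t  = GapAbove.run rest t z<t t≤s

record RunSplit (xs : List ℕ) (v k : ℕ) : Set where
  field
    below above : List ℕ
    split       : xs ≡ below ++ range v k ++ above
    below<      : All (_< v) below
    above≥      : All (v + k ≤_) above

private
  run-prefix : ∀ v k xs → Increasing xs → All (v ≤_) xs → (∀ t → v ≤ t → t < v + k → t ∈ xs) →
    ∃[ above ] (xs ≡ range v k ++ above × All (v + k ≤_) above)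
  run-prefix v zero    xs _ v≤xs _ = xs , refl , subst (λ m → All (m ≤_) xs) (sym (+-identityʳ v)) v≤xs
  run-prefix v (suc k) xs inc v≤xs run with run v ≤-refl (subst (v <_) (sym (+-suc v k)) (s≤s (m≤m+n v k)))
  run-prefix v (suc k) (h ∷ t) (h<t ∷ inc) (v≤h ∷ _) run | v∈ with ≤-antisym (increasing-head (h<t ∷ inc) v∈) v≤h
  ... | refl with run-prefix (suc h) k t inc h<t run′
    where
    run′ : ∀ y → suc h ≤ y → y < suc h + k → y ∈ t
    run′ y h<y y< with run y (<⇒≤ h<y) (subst (y <_) (sym (+-suc h k)) y<)
    ... | here refl = ⊥-elim (<-irrefl refl h<y)
    ... | there y∈t = y∈t
  ... | above , t≡ , above≥ = above , cong (h ∷_) t≡ , subst (λ m → All (m ≤_) above) (sym (+-suc h k)) above≥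

  split-below : ∀ v xs → Increasing xs →
    ∃[ below ] ∃[ rest ] (xs ≡ below ++ rest × All (_< v) below × All (v ≤_) rest × Increasing rest)
  split-below v []      []  = [] , [] , refl , [] , [] , []
  split-below v (h ∷ t) (h<t ∷ inc) with h <? v
  ... | no h≮v = [] , h ∷ t , refl , [] , ≮⇒≥ h≮v ∷ All.map (λ h<y → ≤-trans (≮⇒≥ h≮v) (<⇒≤ h<y)) h<t , h<t ∷ inc
  ... | yes h<v with split-below v t inc
  ...   | below , rest , t≡ , below< , rest≥ , inc′ = h ∷ below , rest , cong (h ∷_) t≡ , h<v ∷ below< , rest≥ , inc′

run-split : ∀ v k xs → Increasing xs → (∀ t → v ≤ t → t < v + k → t ∈ xs) → RunSplit xs v k
run-split v k xs inc run with split-below v xs inc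
... | below , rest , xs≡ , below< , rest≥ , inc′ with run-prefix v k rest inc′ rest≥ run′
  where
  run′ : ∀ t → v ≤ t → t < v + k → t ∈ rest
  run′ t v≤t t< with ∈-++⁻ below (subst (t ∈_) xs≡ (run t v≤t t<))
  ... | inj₁ t∈below = ⊥-elim (<⇒≱ (All.lookup below< t∈below) v≤t)
  ... | inj₂ t∈rest  = t∈rest
... | above , rest≡ , above≥ = record
  { below = below ; above = above ; split = trans xs≡ (cong (below ++_) rest≡) ; below< = below< ; above≥ = above≥ }

record Shape (A B : List ℕ) (v s : ℕ) : Set where
  field
    m      : ℕ
    v+m≡s  : v + m ≡ s
    B₁ B₂ A₁ A₂ : List ℕ
    B≡     : B ≡ B₁ ++ range v (suc m) ++ B₂
    A≡     : A ≡ A₁ ++ range v m ++ A₂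
    B₁<    : All (_< v) B₁
    B₂>    : All (suc (suc s) ≤_) B₂
    A₁<    : All (λ x → suc x < v) A₁
    A₂≥    : All (s ≤_) A₂

module AroundUnpaired (A B : List ℕ) (u : ℕ) (us : List ℕ) (incA : Increasing A) (incB : Increasing B)
                      (unpaired≡ : unpairedF (reverse A) B ≡ u ∷ us) where

  v s m : ℕ
  v = maxOf u us
  s = nextGapF (suc (length B)) B v
  m = s ∸ v

  private
    X : List ℕ
    X = reverse A

    v∈U : v ∈ unpairedF X B
    v∈U = subst (v ∈_) (sym unpaired≡) (maxOf-∈ u us)

    gap : GapAbove B v s
    gap = nextGap-spec B (suc (length B)) v (s≤s (count-≤-length (v <ᵇ_) B)) (unpaired-⊆ X B v∈U)

    v+m≡s : v + m ≡ s
    v+m≡s = m+[n∸m]≡n (GapAbove.z≤s gap)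

    v+1+m≡1+s : v + suc m ≡ suc s
    v+1+m≡1+s = trans (+-suc v m) (cong suc v+m≡s)

    splitB : RunSplit B v (suc m)
    splitB = run-split v (suc m) B incB (λ t v≤t t< → GapAbove.run gap t v≤t (≤-pred (subst (t <_) v+1+m≡1+s t<)))

    B₂-above-gap : ∀ {y} → y ∈ RunSplit.above splitB → suc (suc s) ≤ y
    B₂-above-gap {y} y∈ with m≤n⇒m<n∨m≡n (subst (_≤ y) v+1+m≡1+s (All.lookup (RunSplit.above≥ splitB) y∈))
    ... | inj₁ 1+s<y = 1+s<y
    ... | inj₂ refl  = ⊥-elim (GapAbove.gap gap (subst (_ ∈_) (sym (RunSplit.split splitB))
                         (∈-++⁺ʳ (RunSplit.below splitB) (∈-++⁺ʳ (range v (suc m)) y∈))))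

    run-in-A : ∀ t → v ≤ t → t < v + m → t ∈ A
    run-in-A t v≤t t< with t ∈? X
    ... | yes t∈X = reverse⁻ t∈X
    ... | no  t∉X = ⊥-elim (<⇒≱ (s≤s v≤t) (maxOf-≥ u us (subst (suc t ∈_) unpaired≡ t+1-unpaired)))
      where
      t<s : t < s
      t<s = subst (t <_) v+m≡s t<
      t+1-unpaired : suc t ∈ unpairedF X B
      t+1-unpaired = successor-stays-unpaired v t v≤t X B incB (reverse-decreasing A incA) v∈U t∉X
                       (GapAbove.run gap (suc t) (≤-trans v≤t (n≤1+n t)) t<s)
                       (λ z v≤z z≤t _ → GapAbove.run gap z v≤z (≤-trans z≤t (<⇒≤ t<s)))

    splitA : RunSplit A v m
    splitA = run-split v m A incA run-in-A

    A₁-below-predecessor : ∀ {y} → y ∈ RunSplit.below splitA → suc y < v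
    A₁-below-predecessor {y} y∈ with m≤n⇒m<n∨m≡n (All.lookup (RunSplit.below< splitA) y∈)
    ... | inj₁ 1+y<v = 1+y<v
    ... | inj₂ 1+y≡v = ⊥-elim (unpaired-not-successor X B incB v∈U
                         (reverse⁺ (subst (y ∈_) (sym (RunSplit.split splitA)) (∈-++⁺ˡ y∈))) 1+y≡v)

  -- The run [v, s] of r^{i+1} is matched by the run [v, s - 1] in r^i: a gap t ∉ r^i there would
  -- leave t + 1 > v unpaired, and a letter v - 1 of r^i would have paired v.
  shape : Shape A B v s
  shape = record
    { m = m ; v+m≡s = v+m≡s
    ; B₁ = RunSplit.below splitB ; B₂ = RunSplit.above splitB ; A₁ = RunSplit.below splitA ; A₂ = RunSplit.above splitA
    ; B≡ = RunSplit.split splitB ; A≡ = RunSplit.split splitA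
    ; B₁< = RunSplit.below< splitB
    ; B₂> = All.tabulate B₂-above-gap
    ; A₁< = All.tabulate A₁-below-predecessor
    ; A₂≥ = subst (λ k → All (k ≤_) (RunSplit.above splitA)) v+m≡s (RunSplit.above≥ splitA)
    }

-- Moving the unpaired letter

increasing-++⁻ʳ : ∀ xs {ys} → Increasing (xs ++ ys) → Increasing ys
increasing-++⁻ʳ []       inc       = inc
increasing-++⁻ʳ (x ∷ xs) (_ ∷ inc) = increasing-++⁻ʳ xs inc

insertSorted-after : ∀ s xs ys → All (_< s) xs → All (suc s ≤_) ys → insertSorted s (xs ++ ys) ≡ xs ++ s ∷ ys
insertSorted-after s []       []       []         []           = refl
insertSorted-after s []       (y ∷ ys) []         (s<y ∷ _)    rewrite ≤ᵇ-true (<⇒≤ s<y) = refl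
insertSorted-after s (x ∷ xs) ys       (x<s ∷ xs<s) ys>s rewrite ≤ᵇ-false x<s = cong (x ∷_) (insertSorted-after s xs ys xs<s ys>s)

removeFirst-after : ∀ v xs ys → All (_< v) xs → removeFirst (v ≡ᵇ_) (xs ++ v ∷ ys) ≡ xs ++ ys
removeFirst-after v []       ys []           rewrite ≡ᵇ-refl v = refl
removeFirst-after v (x ∷ xs) ys (x<v ∷ xs<v) rewrite ≡ᵇ-false {v} {x} (λ e → <-irrefl (sym e) x<v) =
  cong (x ∷_) (removeFirst-after v xs ys xs<v)

all-distant : ∀ {P Q : ℕ → Set} xs ys → All P xs → All Q ys → (∀ {a b} → P a → Q b → Distant a b) →
  All (λ a → All (Distant a) ys) xs
all-distant xs ys Pxs Qys d = All.map (λ Pa → All.map (d Pa) Qys) Pxs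

wordAct-++₃ : ∀ xs ys zs x → wordAct (xs ++ ys ++ zs) x ≡ wordAct xs (wordAct ys (wordAct zs x))
wordAct-++₃ xs ys zs x = trans (wordAct-++ xs (ys ++ zs) x) (cong (wordAct xs) (wordAct-++ ys zs x))

module Exchange {A B : List ℕ} {v s : ℕ} (shape : Shape A B v s) where
  open Shape shape

  Run Run⁺ Run⁻ : List ℕ
  Run  = range v (suc m)
  Run⁺ = range (suc v) m
  Run⁻ = range v m

  private
    v≤s : v ≤ s
    v≤s = subst (v ≤_) v+m≡s (m≤m+n v m)

    Run-bounds : All (λ r → v ≤ r × r ≤ s) Run
    Run-bounds = All.map (λ {r} b → proj₁ b , ≤-pred (subst (r <_) (trans (+-suc v m) (cong suc v+m≡s)) (proj₂ b))) (range-bounds v (suc m))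

    Run⁺-bounds : All (λ r → suc v ≤ r × r ≤ s) Run⁺
    Run⁺-bounds = All.map (λ {r} b → proj₁ b , ≤-pred (subst (r <_) (cong suc v+m≡s) (proj₂ b))) (range-bounds (suc v) m)

    Run⁻-bounds : All (λ r → v ≤ r × suc r ≤ s) Run⁻
    Run⁻-bounds = All.map (λ {r} b → proj₁ b , subst (r <_) v+m≡s (proj₂ b)) (range-bounds v m)

    B₂-A₁ : All (λ b → All (Distant b) A₁) B₂
    B₂-A₁ = all-distant B₂ A₁ B₂> A₁< (λ b a → inj₂ (<-trans (<-≤-trans a v≤s) (≤-trans (n≤1+n _) b)))

    B₂-Run : All (λ b → All (Distant b) Run) B₂
    B₂-Run = all-distant B₂ Run B₂> Run-bounds (λ b r → inj₂ (<-≤-trans (s≤s (s≤s (proj₂ r))) b))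

    B₂-Run⁻ : All (λ b → All (Distant b) Run⁻) B₂
    B₂-Run⁻ = all-distant B₂ Run⁻ B₂> Run⁻-bounds (λ b r → inj₂ (<-≤-trans (s≤s (≤-trans (proj₂ r) (n≤1+n s))) b))

    B₂-s : All (λ b → All (Distant b) [ s ]) B₂
    B₂-s = All.map (λ b → inj₂ b ∷ []) B₂>

    Run-A₁ : All (λ r → All (Distant r) A₁) Run
    Run-A₁ = all-distant Run A₁ Run-bounds A₁< (λ r a → inj₂ (<-≤-trans a (proj₁ r)))

    Run⁺-A₁ : All (λ r → All (Distant r) A₁) Run⁺
    Run⁺-A₁ = all-distant Run⁺ A₁ Run⁺-bounds A₁< (λ r a → inj₂ (<-≤-trans a (≤-trans (n≤1+n v) (proj₁ r))))

    Run≡Run⁻∷ʳs : Run ≡ Run⁻ ++ [ s ]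
    Run≡Run⁻∷ʳs = trans (range-∷ʳ v m) (cong (λ k → Run⁻ ++ [ k ]) v+m≡s)

  -- Moving v out of the run of r^{i+1} and s into r^i is the braid-type identity of cycle-braid,
  -- once the distant letters of B₂ and A₁ have been commuted out of the way.
  exchange-core : ∀ y → wordAct Run⁺ (wordAct B₂ (wordAct A₁ (wordAct Run y)))
                      ≡ wordAct Run (wordAct B₂ (wordAct A₁ (wordAct Run⁻ y)))
  exchange-core y = begin
    wordAct Run⁺ (wordAct B₂ (wordAct A₁ (wordAct Run y)))
      ≡⟨ cong (wordAct Run⁺) (wordAct-comm B₂ A₁ _ B₂-A₁) ⟩
    wordAct Run⁺ (wordAct A₁ (wordAct B₂ (wordAct Run y)))
      ≡⟨ cong (wordAct Run⁺ ∘ wordAct A₁) (wordAct-comm B₂ Run y B₂-Run) ⟩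
    wordAct Run⁺ (wordAct A₁ (wordAct Run (wordAct B₂ y)))
      ≡⟨ wordAct-comm Run⁺ A₁ _ Run⁺-A₁ ⟩
    wordAct A₁ (wordAct Run⁺ (wordAct Run (wordAct B₂ y)))
      ≡⟨ cong (wordAct A₁) (sym (cycle-braid v m (wordAct B₂ y))) ⟩
    wordAct A₁ (wordAct Run (wordAct Run⁻ (wordAct B₂ y)))
      ≡⟨ sym (wordAct-comm Run A₁ _ Run-A₁) ⟩
    wordAct Run (wordAct A₁ (wordAct Run⁻ (wordAct B₂ y)))
      ≡⟨ cong (wordAct Run ∘ wordAct A₁) (sym (wordAct-comm B₂ Run⁻ y B₂-Run⁻)) ⟩
    wordAct Run (wordAct A₁ (wordAct B₂ (wordAct Run⁻ y)))
      ≡⟨ cong (wordAct Run) (sym (wordAct-comm B₂ A₁ _ B₂-A₁)) ⟩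
    wordAct Run (wordAct B₂ (wordAct A₁ (wordAct Run⁻ y))) ∎
    where open ≡-Reasoning

  exchange-word : ∀ x → wordAct ((B₁ ++ Run⁺ ++ B₂) ++ (A₁ ++ Run ++ A₂)) x ≡ wordAct ((B₁ ++ Run ++ B₂) ++ (A₁ ++ Run⁻ ++ A₂)) x
  exchange-word x = begin
    wordAct ((B₁ ++ Run⁺ ++ B₂) ++ (A₁ ++ Run ++ A₂)) x
      ≡⟨ wordAct-++ (B₁ ++ Run⁺ ++ B₂) _ x ⟩
    wordAct (B₁ ++ Run⁺ ++ B₂) (wordAct (A₁ ++ Run ++ A₂) x)
      ≡⟨ trans (wordAct-++₃ B₁ Run⁺ B₂ _) (cong (wordAct B₁ ∘ wordAct Run⁺ ∘ wordAct B₂) (wordAct-++₃ A₁ Run A₂ x)) ⟩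
    wordAct B₁ (wordAct Run⁺ (wordAct B₂ (wordAct A₁ (wordAct Run (wordAct A₂ x)))))
      ≡⟨ cong (wordAct B₁) (exchange-core (wordAct A₂ x)) ⟩
    wordAct B₁ (wordAct Run (wordAct B₂ (wordAct A₁ (wordAct Run⁻ (wordAct A₂ x)))))
      ≡⟨ sym (trans (wordAct-++₃ B₁ Run B₂ _) (cong (wordAct B₁ ∘ wordAct Run ∘ wordAct B₂) (wordAct-++₃ A₁ Run⁻ A₂ x))) ⟩
    wordAct (B₁ ++ Run ++ B₂) (wordAct (A₁ ++ Run⁻ ++ A₂) x)
      ≡⟨ sym (wordAct-++ (B₁ ++ Run ++ B₂) _ x) ⟩
    wordAct ((B₁ ++ Run ++ B₂) ++ (A₁ ++ Run⁻ ++ A₂)) x ∎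
    where open ≡-Reasoning

  exchange-length : length ((B₁ ++ Run⁺ ++ B₂) ++ (A₁ ++ Run ++ A₂)) ≡ length ((B₁ ++ Run ++ B₂) ++ (A₁ ++ Run⁻ ++ A₂))
  exchange-length = begin
    length ((B₁ ++ Run⁺ ++ B₂) ++ (A₁ ++ Run ++ A₂))
      ≡⟨ lengths Run⁺ B₂ Run A₂ ⟩
    (length B₁ + (length Run⁺ + length B₂)) + (length A₁ + (length Run + length A₂))
      ≡⟨ cong₂ (λ k l → (length B₁ + (k + length B₂)) + (length A₁ + (l + length A₂))) (length-range (suc v) m) (length-range v (suc m)) ⟩
    (length B₁ + (m + length B₂)) + (length A₁ + (suc m + length A₂))
      ≡⟨ shift (length B₁) (length B₂) (length A₁) (length A₂) m ⟩
    (length B₁ + (suc m + length B₂)) + (length A₁ + (m + length A₂))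
      ≡⟨ sym (cong₂ (λ k l → (length B₁ + (k + length B₂)) + (length A₁ + (l + length A₂))) (length-range v (suc m)) (length-range v m)) ⟩
    (length B₁ + (length Run + length B₂)) + (length A₁ + (length Run⁻ + length A₂))
      ≡⟨ sym (lengths Run B₂ Run⁻ A₂) ⟩
    length ((B₁ ++ Run ++ B₂) ++ (A₁ ++ Run⁻ ++ A₂)) ∎
    where
    open ≡-Reasoning
    lengths : ∀ R Y R′ Z → length ((B₁ ++ R ++ Y) ++ (A₁ ++ R′ ++ Z)) ≡ (length B₁ + (length R + length Y)) + (length A₁ + (length R′ + length Z))
    lengths R Y R′ Z = trans (length-++ (B₁ ++ R ++ Y)) (cong₂ _+_
      (trans (length-++ B₁) (cong (length B₁ +_) (length-++ R)))
      (trans (length-++ A₁) (cong (length A₁ +_) (length-++ R′))))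
    shift : ∀ a b c d m → (a + (m + b)) + (c + (suc m + d)) ≡ (a + (suc m + b)) + (c + (m + d))
    shift = solve-∀

  removed : removeFirst (v ≡ᵇ_) B ≡ B₁ ++ Run⁺ ++ B₂
  removed = trans (cong (removeFirst (v ≡ᵇ_)) B≡) (removeFirst-after v B₁ (Run⁺ ++ B₂) B₁<)

  inserted : All (suc s ≤_) A₂ → insertSorted s A ≡ A₁ ++ Run ++ A₂
  inserted A₂>s = begin
    insertSorted s A                 ≡⟨ cong (insertSorted s) (trans A≡ (sym (++-assoc A₁ Run⁻ A₂))) ⟩
    insertSorted s ((A₁ ++ Run⁻) ++ A₂) ≡⟨ insertSorted-after s (A₁ ++ Run⁻) A₂ below-s A₂>s ⟩
    (A₁ ++ Run⁻) ++ s ∷ A₂           ≡⟨ ++-assoc A₁ Run⁻ (s ∷ A₂) ⟩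
    A₁ ++ Run⁻ ++ s ∷ A₂             ≡⟨ cong (A₁ ++_) (sym (++-assoc Run⁻ [ s ] A₂)) ⟩
    A₁ ++ (Run⁻ ++ [ s ]) ++ A₂      ≡⟨ cong (λ R → A₁ ++ R ++ A₂) (sym Run≡Run⁻∷ʳs) ⟩
    A₁ ++ Run ++ A₂                  ∎
    where
    open ≡-Reasoning
    below-s : All (_< s) (A₁ ++ Run⁻)
    below-s = AllP.++⁺ (All.map (λ a → <-≤-trans (<-trans (n<1+n _) a) v≤s) A₁<) (All.map proj₂ Run⁻-bounds)

  s∈A-or-above : Increasing A → All (suc s ≤_) A₂ ⊎ ∃[ A₂′ ] A₂ ≡ s ∷ A₂′
  s∈A-or-above incA = cases A₂ (increasing-++⁻ʳ (A₁ ++ Run⁻) (subst Increasing (trans A≡ (sym (++-assoc A₁ Run⁻ A₂))) incA)) A₂≥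
    where
    cases : ∀ xs → Increasing xs → All (s ≤_) xs → All (suc s ≤_) xs ⊎ ∃[ xs′ ] xs ≡ s ∷ xs′
    cases []      _           _           = inj₁ []
    cases (h ∷ t) (h<t ∷ _)  (s≤h ∷ _) with m≤n⇒m<n∨m≡n s≤h
    ... | inj₂ refl = inj₂ (t , refl)
    ... | inj₁ s<h  = inj₁ (s<h ∷ All.map (<-trans s<h) h<t)

  module Shortening {A₂′ : List ℕ} (A₂≡ : A₂ ≡ s ∷ A₂′) where

    Shortened : List ℕ
    Shortened = B₁ ++ A₁ ++ Run⁺ ++ Run⁻ ++ B₂ ++ A₂′

    private
      BA≡ : B ++ A ≡ (B₁ ++ Run ++ B₂) ++ (A₁ ++ Run⁻ ++ s ∷ A₂′)
      BA≡ = cong₂ _++_ B≡ (trans A≡ (cong (λ R → A₁ ++ Run⁻ ++ R) A₂≡))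

      Run-then-s : ∀ y → wordAct Run (sAct s y) ≡ wordAct Run⁻ y
      Run-then-s y = trans (cong (λ R → wordAct R (sAct s y)) Run≡Run⁻∷ʳs)
                           (trans (wordAct-++ Run⁻ [ s ] (sAct s y)) (cong (wordAct Run⁻) (sAct-involutive s y)))

    -- The letter s at the head of A₂ cancels against the run, so B ++ A was not reduced.
    shortened-word : ∀ x → wordAct (B ++ A) x ≡ wordAct Shortened x
    shortened-word x = begin
      wordAct (B ++ A) x
        ≡⟨ cong (λ ws → wordAct ws x) BA≡ ⟩
      wordAct ((B₁ ++ Run ++ B₂) ++ (A₁ ++ Run⁻ ++ s ∷ A₂′)) x
        ≡⟨ trans (wordAct-++ (B₁ ++ Run ++ B₂) _ x) (trans (wordAct-++₃ B₁ Run B₂ _) (cong (wordAct B₁ ∘ wordAct Run ∘ wordAct B₂) (wordAct-++₃ A₁ Run⁻ (s ∷ A₂′) x))) ⟩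
      wordAct B₁ (wordAct Run (wordAct B₂ (wordAct A₁ (wordAct Run⁻ (sAct s y)))))
        ≡⟨ cong (wordAct B₁ ∘ wordAct Run) (wordAct-comm B₂ A₁ _ B₂-A₁) ⟩
      wordAct B₁ (wordAct Run (wordAct A₁ (wordAct B₂ (wordAct Run⁻ (sAct s y)))))
        ≡⟨ cong (wordAct B₁ ∘ wordAct Run ∘ wordAct A₁) (wordAct-comm B₂ Run⁻ _ B₂-Run⁻) ⟩
      wordAct B₁ (wordAct Run (wordAct A₁ (wordAct Run⁻ (wordAct B₂ (sAct s y)))))
        ≡⟨ cong (wordAct B₁ ∘ wordAct Run ∘ wordAct A₁ ∘ wordAct Run⁻) (wordAct-comm B₂ [ s ] y B₂-s) ⟩
      wordAct B₁ (wordAct Run (wordAct A₁ (wordAct Run⁻ (sAct s (wordAct B₂ y)))))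
        ≡⟨ cong (wordAct B₁) (wordAct-comm Run A₁ _ Run-A₁) ⟩
      wordAct B₁ (wordAct A₁ (wordAct Run (wordAct Run⁻ (sAct s (wordAct B₂ y)))))
        ≡⟨ cong (wordAct B₁ ∘ wordAct A₁) (cycle-braid v m _) ⟩
      wordAct B₁ (wordAct A₁ (wordAct Run⁺ (wordAct Run (sAct s (wordAct B₂ y)))))
        ≡⟨ cong (wordAct B₁ ∘ wordAct A₁ ∘ wordAct Run⁺) (Run-then-s (wordAct B₂ y)) ⟩
      wordAct B₁ (wordAct A₁ (wordAct Run⁺ (wordAct Run⁻ (wordAct B₂ y))))
        ≡⟨ sym (trans (wordAct-++₃ B₁ A₁ (Run⁺ ++ Run⁻ ++ B₂ ++ A₂′) x)
                 (cong (wordAct B₁ ∘ wordAct A₁) (trans (wordAct-++₃ Run⁺ Run⁻ (B₂ ++ A₂′) x)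
                   (cong (wordAct Run⁺ ∘ wordAct Run⁻) (wordAct-++ B₂ A₂′ x))))) ⟩
      wordAct Shortened x ∎
      where
      open ≡-Reasoning
      y : ℕ
      y = wordAct A₂′ x

    shortened-length : 2 + length Shortened ≡ length (B ++ A)
    shortened-length = begin
      2 + length Shortened
        ≡⟨ cong (2 +_) (trans (length-++ B₁) (cong (length B₁ +_) (trans (length-++ A₁) (cong (length A₁ +_)
             (trans (length-++ Run⁺) (cong₂ _+_ (length-range (suc v) m) (trans (length-++ Run⁻) (cong₂ _+_ (length-range v m) (length-++ B₂))))))))) ⟩
      2 + (length B₁ + (length A₁ + (m + (m + (length B₂ + length A₂′)))))
        ≡⟨ rearrange (length B₁) (length B₂) (length A₁) (length A₂′) m ⟩
      (length B₁ + (suc m + length B₂)) + (length A₁ + (m + suc (length A₂′)))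
        ≡⟨ sym (trans (length-++ (B₁ ++ Run ++ B₂)) (cong₂ _+_
             (trans (length-++ B₁) (cong (length B₁ +_) (trans (length-++ Run) (cong (_+ length B₂) (length-range v (suc m))))))
             (trans (length-++ A₁) (cong (length A₁ +_) (trans (length-++ Run⁻) (cong (_+ suc (length A₂′)) (length-range v m))))))) ⟩
      length ((B₁ ++ Run ++ B₂) ++ (A₁ ++ Run⁻ ++ s ∷ A₂′))
        ≡⟨ cong length (sym BA≡) ⟩
      length (B ++ A) ∎
      where
      open ≡-Reasoning
      rearrange : ∀ a b c d m → 2 + (a + (c + (m + (m + (b + d))))) ≡ (a + (suc m + b)) + (c + (m + suc d))
      rearrange = solve-∀

    shortened-all : ∀ {P : ℕ → Set} → All P (B ++ A) → All P Shortened
    shortened-all {P} all with AllP.++⁻ (B₁ ++ Run ++ B₂) (subst (All P) BA≡ all)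
    ... | allB , allA with AllP.++⁻ B₁ allB | AllP.++⁻ A₁ allA
    ... | b₁ , runB₂ | a₁ , run⁻A₂ with AllP.++⁻ Run runB₂ | AllP.++⁻ Run⁻ run⁻A₂
    ... | _ ∷ run⁺ , b₂ | run⁻ , _ ∷ a₂′ = AllP.++⁺ b₁ (AllP.++⁺ a₁ (AllP.++⁺ run⁺ (AllP.++⁺ run⁻ (AllP.++⁺ b₂ a₂′))))

removeFirst-map : ∀ (p q : ℕ → Bool) (f : ℕ → ℕ) xs → (∀ x → p (f x) ≡ q x) → removeFirst p (map f xs) ≡ map f (removeFirst q xs)
removeFirst-map p q f []       p∘f≗q = refl
removeFirst-map p q f (x ∷ xs) p∘f≗q rewrite p∘f≗q x with q x
... | true  = refl
... | false = cong (f x ∷_) (removeFirst-map p q f xs p∘f≗q)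

-- Letters of the crosses of rows i + 1 and i + 2: column j gives i + j and i + 1 + j respectively.
module RowLetters (i : ℕ) where

  upper lower : ℕ → ℕ
  upper j = i + j
  lower j = suc (i + j)

  unpaired-correspondence : ∀ as bs → unpairedF (map upper as) (map lower bs) ≡ map lower (unpairedPD as bs)
  unpaired-correspondence []       bs = refl
  unpaired-correspondence (a ∷ as) bs =
    trans (cong (unpairedF (map upper as)) (removeFirst-map _ _ lower bs (λ b → trans (<ᵇ-suc (i + a) (i + b)) (≤ᵇ-+ˡ i a b))))
          (unpaired-correspondence as (removeFirst (a ≤ᵇ_) bs))

  maxOf-lower : ∀ x xs → maxOf (lower x) (map lower xs) ≡ lower (maxOf x xs)
  maxOf-lower x []       = refl
  maxOf-lower x (y ∷ ys) = trans (cong (lower y ⊔_) (maxOf-lower x ys)) (cong suc (sym (+-distribˡ-⊔ i y (maxOf x ys))))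

  insertSorted-upper : ∀ q xs → map upper (insertSorted q xs) ≡ insertSorted (upper q) (map upper xs)
  insertSorted-upper q []       = refl
  insertSorted-upper q (x ∷ xs) rewrite ≤ᵇ-+ˡ i q x with q ≤ᵇ x
  ... | true  = refl
  ... | false = cong (upper x ∷_) (insertSorted-upper q xs)

  removeFirst-lower : ∀ ℓ xs → map lower (removeFirst (ℓ ≡ᵇ_) xs) ≡ removeFirst (lower ℓ ≡ᵇ_) (map lower xs)
  removeFirst-lower ℓ xs = sym (removeFirst-map _ _ lower xs (λ b → ≡ᵇ-+ˡ i ℓ b))

removeFirst-none : ∀ p xs → All (λ x → p x ≡ false) xs → removeFirst p xs ≡ xs
removeFirst-none p []       []         = refl
removeFirst-none p (x ∷ xs) (px ∷ pxs) rewrite px = cong (x ∷_) (removeFirst-none p xs pxs)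

filterᵇ-cong-on : ∀ (p q : ℕ → Bool) xs → All (λ x → p x ≡ q x) xs → filterᵇ p xs ≡ filterᵇ q xs
filterᵇ-cong-on p q []       []           = refl
filterᵇ-cong-on p q (x ∷ xs) (px≡qx ∷ eqs) with p x | q x
filterᵇ-cong-on p q (x ∷ xs) (refl ∷ eqs) | true  | true  = cong (x ∷_) (filterᵇ-cong-on p q xs eqs)
filterᵇ-cong-on p q (x ∷ xs) (refl ∷ eqs) | false | false = filterᵇ-cong-on p q xs eqs

insertSorted-head : ∀ q xs → All (q ≤_) xs → insertSorted q xs ≡ q ∷ xs
insertSorted-head q []       []         = refl
insertSorted-head q (x ∷ xs) (q≤x ∷ _) rewrite ≤ᵇ-true q≤x = refl

filter-without : ∀ (p : ℕ → Bool) ℓ xs → Increasing xs →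
  filterᵇ (λ b → if b ≡ᵇ ℓ then false else p b) xs ≡ removeFirst (ℓ ≡ᵇ_) (filterᵇ p xs)
filter-without p ℓ []       []          = refl
filter-without p ℓ (x ∷ xs) (x<xs ∷ inc) with x ≟ ℓ
... | yes refl rewrite ≡ᵇ-refl x =
  trans (filterᵇ-cong-on _ p xs (All.map (λ x<y → unchanged (λ y≡x → <-irrefl (sym y≡x) x<y)) x<xs)) (sym drop-x)
  where
  unchanged : ∀ {y} → y ≢ x → (if y ≡ᵇ x then false else p y) ≡ p y
  unchanged y≢x rewrite ≡ᵇ-false y≢x = refl
  drop-x : removeFirst (x ≡ᵇ_) (filterᵇ p (x ∷ xs)) ≡ filterᵇ p xs
  drop-x with p x
  ... | true  rewrite ≡ᵇ-refl x = refl
  ... | false = removeFirst-none (x ≡ᵇ_) (filterᵇ p xs)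
                  (AllP.filter⁺ (T? ∘ p) (All.map (λ x<y → ≡ᵇ-false (λ x≡y → <-irrefl x≡y x<y)) x<xs))
... | no x≢ℓ rewrite ≡ᵇ-false x≢ℓ with p x
...   | true  rewrite ≡ᵇ-false (x≢ℓ ∘ sym) = cong (x ∷_) (filter-without p ℓ xs inc)
...   | false = filter-without p ℓ xs inc

filter-with : ∀ (p : ℕ → Bool) q j m → j ≤ q → q < j + m → p q ≡ false →
  filterᵇ (λ b → if b ≡ᵇ q then true else p b) (range j m) ≡ insertSorted q (filterᵇ p (range j m))
filter-with p q j zero    j≤q q<j+0 _ = ⊥-elim (<-irrefl refl (<-≤-trans q<j+0 (≤-trans (≤-reflexive (+-identityʳ j)) j≤q)))
filter-with p q j (suc m) j≤q q<     pq with m≤n⇒m<n∨m≡n j≤q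
... | inj₂ refl rewrite ≡ᵇ-refl j | pq =
  trans (cong (j ∷_) (filterᵇ-cong-on _ p (range (suc j) m) (All.map (λ b → unchanged (proj₁ b)) (range-bounds (suc j) m))))
        (sym (insertSorted-head j _ (AllP.filter⁺ (T? ∘ p) (All.map (<⇒≤ ∘ proj₁) (range-bounds (suc j) m)))))
  where
  unchanged : ∀ {y} → j < y → (if y ≡ᵇ j then true else p y) ≡ p y
  unchanged j<y rewrite ≡ᵇ-false (λ y≡j → <-irrefl (sym y≡j) j<y) = refl
... | inj₁ j<q rewrite ≡ᵇ-false (λ j≡q → <-irrefl j≡q j<q) with p j
...   | true  rewrite ≤ᵇ-false j<q = cong (j ∷_) (filter-with p q (suc j) m j<q (subst (q <_) (+-suc j m) q<) pq)
...   | false = filter-with p q (suc j) m j<q (subst (q <_) (+-suc j m) q<) pq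

module _ (D : PipeDream) (r n i : ℕ) (bounded : ∀ c → D r c ≡ true → 1 ≤ c × c ≤ n) where

  private
    lower : ℕ → ℕ
    lower = RowLetters.lower i

    row : List ℕ
    row = map lower (filterᵇ (D r) (range 1 n))

    elemᵇ-row : ∀ c → elemᵇ (lower c) row ≡ D r c
    elemᵇ-row c with D r c in cross
    ... | true  = elemᵇ-true (∈-map⁺ lower (∈-filter⁺ (T? ∘ D r) (∈-range⁺ 1 n (proj₁ (bounded c cross)) (s≤s (proj₂ (bounded c cross))))
                                             (subst T (sym cross) _)))
    ... | false = elemᵇ-false not-in-row
      where
      not-in-row : lower c ∉ row
      not-in-row c∈ with ∈-map⁻ lower c∈
      ... | c′ , c′∈ , lc≡lc′ with ∈-filter⁻ (T? ∘ D r) {xs = range 1 n} c′∈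
      ...   | _ , cross′ = subst T (trans (cong (D r) (sym (+-cancelˡ-≡ i _ _ (suc-injective lc≡lc′)))) cross) cross′

  nextGap≡nextFree : ∀ f f′ c → count (i + c <ᵇ_) row < f′ → n < c + f → nextGapF f′ row (i + c) ≡ i + nextFree D r f c
  nextGap≡nextFree f (suc f′) c fuel′ n<c+f rewrite elemᵇ-row c with D r c in cross
  ... | false = cong (i +_) (sym (free-here f cross))
    where
    free-here : ∀ f → D r c ≡ false → nextFree D r f c ≡ c
    free-here zero    _     = refl
    free-here (suc f) elbow rewrite elbow = refl
  nextGap≡nextFree zero (suc f′) c fuel′ n<c+0 | true =
    ⊥-elim (<-irrefl refl (<-≤-trans n<c+0 (≤-trans (≤-reflexive (+-identityʳ c)) (proj₂ (bounded c cross)))))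
  nextGap≡nextFree (suc f) (suc f′) c fuel′ n<c+f | true rewrite cross =
    trans (cong (nextGapF f′ row) (sym (+-suc i c))) (nextGap≡nextFree f f′ (suc c)
      (subst (λ z → count (z <ᵇ_) row < f′) (sym (+-suc i c))
        (≤-pred (<-≤-trans (s≤s (count-above-suc (i + c) row (elemᵇ-true⁻ _ row (trans (elemᵇ-row c) cross)))) fuel′)))
      (subst (n <_) (+-suc c f) n<c+f))

block-applyUpTo : ∀ (f : ℕ → List ℕ) m k → k < m → block (applyUpTo f m) (suc k) ≡ f k
block-applyUpTo f (suc m) zero    _         = refl
block-applyUpTo f (suc m) (suc k) (s≤s k<m) = block-applyUpTo (f ∘ suc) m k k<m

block-applyUpTo-beyond : ∀ (f : ℕ → List ℕ) m k → m ≤ k → block (applyUpTo f m) (suc k) ≡ []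
block-applyUpTo-beyond f zero    k       _         = refl
block-applyUpTo-beyond f (suc m) (suc k) (s≤s m≤k) = block-applyUpTo-beyond (f ∘ suc) m k m≤k

block-at : ∀ Lo {a : List ℕ} {rest} → block (Lo ++ a ∷ rest) (suc (length Lo)) ≡ a
block-at []       = refl
block-at (_ ∷ Lo) = block-at Lo

updBlock-at : ∀ Lo (F G : List ℕ → List ℕ) {a b rest} →
  updBlock (suc (length Lo)) F (updBlock (suc (suc (length Lo))) G (Lo ++ a ∷ b ∷ rest)) ≡ Lo ++ F a ∷ G b ∷ rest
updBlock-at []       F G = refl
updBlock-at (x ∷ Lo) F G = cong (x ∷_) (updBlock-at Lo F G)

factWord-around : ∀ Lo (a b : List ℕ) Up → factWord (Lo ++ a ∷ b ∷ Up) ≡ factWord Up ++ (b ++ a) ++ factWord Lo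
factWord-around Lo a b Up = begin
  concat (reverse (Lo ++ a ∷ b ∷ Up))                    ≡⟨ cong concat (reverse-++ Lo (a ∷ b ∷ Up)) ⟩
  concat (reverse (a ∷ b ∷ Up) ++ reverse Lo)            ≡⟨ sym (concat-++ (reverse (a ∷ b ∷ Up)) (reverse Lo)) ⟩
  concat (reverse (a ∷ b ∷ Up)) ++ factWord Lo           ≡⟨ cong (λ rs → concat rs ++ factWord Lo) unfold-reverse₂ ⟩
  concat (reverse Up ++ b ∷ a ∷ []) ++ factWord Lo       ≡⟨ cong (_++ factWord Lo) (sym (concat-++ (reverse Up) (b ∷ a ∷ []))) ⟩
  (factWord Up ++ b ++ a ++ []) ++ factWord Lo           ≡⟨ cong (λ w → (factWord Up ++ b ++ w) ++ factWord Lo) (++-identityʳ a) ⟩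
  (factWord Up ++ b ++ a) ++ factWord Lo                 ≡⟨ ++-assoc (factWord Up) (b ++ a) (factWord Lo) ⟩
  factWord Up ++ (b ++ a) ++ factWord Lo                 ∎
  where
  open ≡-Reasoning
  unfold-reverse₂ : reverse (a ∷ b ∷ Up) ≡ reverse Up ++ b ∷ a ∷ []
  unfold-reverse₂ = trans (unfold-reverse a (b ∷ Up)) (trans (cong (_++ [ a ]) (unfold-reverse b Up)) (++-assoc (reverse Up) [ b ] [ a ]))

wordAct-middle : ∀ Top {X Y} Low → (∀ z → wordAct X z ≡ wordAct Y z) → ∀ z → wordAct (Top ++ X ++ Low) z ≡ wordAct (Top ++ Y ++ Low) z
wordAct-middle Top {X} {Y} Low X≗Y z = begin
  wordAct (Top ++ X ++ Low) z                    ≡⟨ wordAct-++₃ Top X Low z ⟩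
  wordAct Top (wordAct X (wordAct Low z))        ≡⟨ cong (wordAct Top) (X≗Y (wordAct Low z)) ⟩
  wordAct Top (wordAct Y (wordAct Low z))        ≡⟨ sym (wordAct-++₃ Top Y Low z) ⟩
  wordAct (Top ++ Y ++ Low) z                    ∎
  where open ≡-Reasoning

length-middle : ∀ Top (X : List ℕ) Low → length (Top ++ X ++ Low) ≡ length Top + (length X + length Low)
length-middle Top X Low = trans (length-++ Top) (cong (length Top +_) (length-++ X))

applyUpTo-around : ∀ {A : Set} (f : ℕ → A) i t →
  applyUpTo f (i + suc (suc t)) ≡ applyUpTo f i ++ f i ∷ f (suc i) ∷ applyUpTo (λ j → f (i + suc (suc j))) t
applyUpTo-around f zero    t = refl
applyUpTo-around f (suc i) t = cong (f 0 ∷_) (applyUpTo-around (f ∘ suc) i t)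

applyUpTo-cong-< : ∀ {A : Set} {f g : ℕ → A} m → (∀ {j} → j < m → f j ≡ g j) → applyUpTo f m ≡ applyUpTo g m
applyUpTo-cong-< zero    f≗g = refl
applyUpTo-cong-< (suc m) f≗g = cong₂ _∷_ (f≗g z<s) (applyUpTo-cong-< m (f≗g ∘ s<s))

increasing⇒strictIncᵇ : ∀ xs → Increasing xs → T (strictIncᵇ xs)
increasing⇒strictIncᵇ []           _                 = _
increasing⇒strictIncᵇ (x ∷ [])     _                 = _
increasing⇒strictIncᵇ (x ∷ y ∷ xs) ((x<y ∷ _) ∷ inc) =
  Equivalence.from T-∧ (<⇒<ᵇ x<y , increasing⇒strictIncᵇ (y ∷ xs) inc)

cutoff-applyUpTo : ∀ k (F : ℕ → List ℕ) m → (∀ j → All (suc (k + j) ≤_) (F j)) → T (cutoffᵇ (suc k) (applyUpTo F m))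
cutoff-applyUpTo k F zero    bound = _
cutoff-applyUpTo k F (suc m) bound with F 0 | bound 0
... | []     | _        = cutoff-applyUpTo (suc k) (F ∘ suc) m (λ j → subst (λ z → All (suc z ≤_) (F (suc j))) (+-suc k j) (bound (suc j)))
... | a ∷ as | k<a ∷ _ =
  Equivalence.from T-∧ (≤⇒≤ᵇ (subst (_≤ a) (cong suc (+-identityʳ k)) k<a) ,
                        cutoff-applyUpTo (suc k) (F ∘ suc) m (λ j → subst (λ z → All (suc z ≤_) (F (suc j))) (+-suc k j) (bound (suc j))))

module _ (n : ℕ) (E : PipeDream) where

  φBlock-increasing : ∀ k → Increasing (φBlock n E k)
  φBlock-increasing k = subst (Increasing ∘ map (k +_)) (sym (rowCols≡filter-range n E (suc k)))
    (APP.map⁺ (AllPairs.map (+-monoʳ-< k) (APP.filter⁺ (T? ∘ E (suc k)) (range-increasing 1 n))))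

  φBlock-above : ∀ k → All (suc k ≤_) (φBlock n E k)
  φBlock-above k = subst (All (suc k ≤_) ∘ map (k +_)) (sym (rowCols≡filter-range n E (suc k)))
    (AllP.map⁺ (AllP.filter⁺ (T? ∘ E (suc k)) (All.map (λ {c} b → subst (_≤ k + c) (+-comm k 1) (+-monoʳ-≤ k (proj₁ b))) (range-bounds 1 n))))

  φ-isRFC : ∀ v → CrossesAllowed n E →
    (∀ x → wordAct (factWord (φ n E)) (suc (toℕ x)) ≡ val v x) → length (factWord (φ n E)) ≡ invCount n v →
    isRFCᵇ n v (φ n E) ≡ true
  φ-isRFC v allowed word length≡ = Equivalence.to T-≡ (Equivalence.from T-∧
    (≡⇒≡ᵇ _ _ (length-applyUpTo (φBlock n E) (n ∸ 1)) , Equivalence.from T-∧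
    (AllP.all⁻ strictIncᵇ (AllP.applyUpTo⁺₂ (φBlock n E) (n ∸ 1) (λ k → increasing⇒strictIncᵇ _ (φBlock-increasing k))) , Equivalence.from T-∧
    (cutoff-applyUpTo 0 (φBlock n E) (n ∸ 1) φBlock-above , Equivalence.from T-∧
    (AllP.all⁻ (λ a → (1 ≤ᵇ a) ∧ (a <ᵇ n)) (subst (All (λ a → T ((1 ≤ᵇ a) ∧ (a <ᵇ n)))) (sym (PipeTracing.factWord-φ n E allowed))
                 (All.map (λ { (1≤a , a<n) → Equivalence.from T-∧ (≤⇒≤ᵇ 1≤a , <⇒<ᵇ a<n) }) (PipeTracing.crosses-valid n E allowed))) ,
     Equivalence.from T-∧
    (AllP.all⁻ (λ x → wordAct (factWord (φ n E)) (suc (toℕ x)) ≡ᵇ val v x) (All.tabulate {xs = allFin n} (λ {x} _ → ≡⇒≡ᵇ _ _ (word x))) , ≡⇒≡ᵇ _ _ length≡))))))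

-- The operators e_i

moveCross : ℕ → PipeDream → ℕ → ℕ → PipeDream
moveCross i D ℓ q a b = if (a ≡ᵇ suc i) ∧ (b ≡ᵇ ℓ) then false else (if (a ≡ᵇ i) ∧ (b ≡ᵇ q) then true else D a b)

ePD-unpaired : ∀ n i D x xs → unpairedPD (reverse (rowCols n D i)) (rowCols n D (suc i)) ≡ x ∷ xs →
  ePD n i D ≡ just (moveCross i D (maxOf x xs) (nextFree D (suc i) (suc (suc n)) (suc (maxOf x xs))))
ePD-unpaired n i D x xs eq with unpairedPD (reverse (rowCols n D i)) (rowCols n D (suc i))
ePD-unpaired n i D x xs refl | .(x ∷ xs) = refl

ePD-paired : ∀ n i D → unpairedPD (reverse (rowCols n D i)) (rowCols n D (suc i)) ≡ [] → ePD n i D ≡ nothing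
ePD-paired n i D eq with unpairedPD (reverse (rowCols n D i)) (rowCols n D (suc i))
ePD-paired n i D refl | .[] = refl

moveLetter : ℕ → Fact → ℕ → List ℕ → Fact
moveLetter i r y ys =
  updBlock i (insertSorted (nextGapF (suc (length (block r (suc i)))) (block r (suc i)) (maxOf y ys)))
             (updBlock (suc i) (removeFirst (maxOf y ys ≡ᵇ_)) r)

eF-unpaired : ∀ n v i r y ys → unpairedF (reverse (block r i)) (block r (suc i)) ≡ y ∷ ys →
  eF n v i r ≡ (if isRFCᵇ n v (moveLetter i r y ys) then just (moveLetter i r y ys) else nothing)
eF-unpaired n v i r y ys eq with unpairedF (reverse (block r i)) (block r (suc i))
eF-unpaired n v i r y ys refl | .(y ∷ ys) = refl

eF-paired : ∀ n v i r → unpairedF (reverse (block r i)) (block r (suc i)) ≡ [] → eF n v i r ≡ nothing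
eF-paired n v i r eq with unpairedF (reverse (block r i)) (block r (suc i))
eF-paired n v i r refl | .[] = refl

module _ (i : ℕ) (D : PipeDream) (ℓ q : ℕ) where

  moveCross-other : ∀ {k} → k ≢ i → k ≢ suc i → ∀ b → moveCross i D ℓ q k b ≡ D k b
  moveCross-other k≢i k≢i+1 b rewrite ≡ᵇ-false k≢i+1 | ≡ᵇ-false k≢i = refl

  moveCross-added : ∀ b → moveCross i D ℓ q i b ≡ (if b ≡ᵇ q then true else D i b)
  moveCross-added b rewrite ≡ᵇ-false {i} {suc i} (1+n≢n ∘ sym) | ≡ᵇ-refl i = refl

  moveCross-removed : ∀ b → moveCross i D ℓ q (suc i) b ≡ (if b ≡ᵇ ℓ then false else D (suc i) b)
  moveCross-removed b rewrite ≡ᵇ-refl i | ≡ᵇ-false {suc i} {i} 1+n≢n with b ≡ᵇ ℓ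
  ... | true  = refl
  ... | false = refl

  moveCross-allowed : ∀ {n} → CrossesAllowed n D → 1 ≤ i → 1 ≤ q → i + q ≤ n → CrossesAllowed n (moveCross i D ℓ q)
  moveCross-allowed allowed 1≤i 1≤q i+q≤n a b cross with (a ≡ᵇ suc i) ∧ (b ≡ᵇ ℓ)
  ... | true  = case cross of λ ()
  ... | false with a ≡ᵇ i in a≡i | b ≡ᵇ q in b≡q
  ...   | true  | true  with refl ← ≡ᵇ-true⁻ {a} a≡i | refl ← ≡ᵇ-true⁻ {b} b≡q = 1≤i , 1≤q , i+q≤n
  ...   | true  | false = allowed a b cross
  ...   | false | _     = allowed a b cross

  module _ (n : ℕ) where

    rowCols-moveCross-other : ∀ {k} → k ≢ i → k ≢ suc i → rowCols n (moveCross i D ℓ q) k ≡ rowCols n D k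
    rowCols-moveCross-other k≢i k≢i+1 =
      filterᵇ-cong-on _ _ (applyUpTo suc n) (All.tabulate (λ {b} _ → moveCross-other k≢i k≢i+1 b))

    rowCols-moveCross-added : 1 ≤ q → q ≤ n → D i q ≡ false → rowCols n (moveCross i D ℓ q) i ≡ insertSorted q (rowCols n D i)
    rowCols-moveCross-added 1≤q q≤n free = begin
      filterᵇ (moveCross i D ℓ q i) (applyUpTo suc n)
        ≡⟨ filterᵇ-cong-on _ _ (applyUpTo suc n) (All.tabulate (λ {b} _ → moveCross-added b)) ⟩
      filterᵇ (λ b → if b ≡ᵇ q then true else D i b) (applyUpTo suc n)
        ≡⟨ cong (filterᵇ _) (applyUpTo-suc≡range n) ⟩
      filterᵇ (λ b → if b ≡ᵇ q then true else D i b) (range 1 n)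
        ≡⟨ filter-with (D i) q 1 n 1≤q (s≤s q≤n) free ⟩
      insertSorted q (filterᵇ (D i) (range 1 n))
        ≡⟨ cong (insertSorted q) (sym (rowCols≡filter-range n D i)) ⟩
      insertSorted q (rowCols n D i) ∎
      where open ≡-Reasoning

    rowCols-moveCross-removed : rowCols n (moveCross i D ℓ q) (suc i) ≡ removeFirst (ℓ ≡ᵇ_) (rowCols n D (suc i))
    rowCols-moveCross-removed = begin
      filterᵇ (moveCross i D ℓ q (suc i)) (applyUpTo suc n)
        ≡⟨ filterᵇ-cong-on _ _ (applyUpTo suc n) (All.tabulate (λ {b} _ → moveCross-removed b)) ⟩
      filterᵇ (λ b → if b ≡ᵇ ℓ then false else D (suc i) b) (applyUpTo suc n)
        ≡⟨ cong (filterᵇ _) (applyUpTo-suc≡range n) ⟩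
      filterᵇ (λ b → if b ≡ᵇ ℓ then false else D (suc i) b) (range 1 n)
        ≡⟨ filter-without (D (suc i)) ℓ (range 1 n) (range-increasing 1 n) ⟩
      removeFirst (ℓ ≡ᵇ_) (filterᵇ (D (suc i)) (range 1 n))
        ≡⟨ cong (removeFirst (ℓ ≡ᵇ_)) (sym (rowCols≡filter-range n D (suc i))) ⟩
      removeFirst (ℓ ≡ᵇ_) (rowCols n D (suc i)) ∎
      where open ≡-Reasoning

-- e_{i+1}, acting on rows i + 1 and i + 2 and on the blocks r^{i+1}, r^{i+2}
module Raising (n : ℕ) (w : Permutation′ n) (D : PipeDream) (rp : RP n w D) (i : ℕ) (i+1<n : suc i < n) where

  open ReducedPipeDream n w D rp
  open RowLetters i

  A B : List ℕ
  A = rowCols n D (suc i)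
  B = rowCols n D (suc (suc i))

  Aφ Bφ : List ℕ
  Aφ = block (φ n D) (suc i)
  Bφ = block (φ n D) (suc (suc i))

  Aφ≡ : Aφ ≡ map upper A
  Aφ≡ = block-applyUpTo (φBlock n D) (n ∸ 1) i (∸-monoˡ-≤ 1 i+1<n)

  Bφ≡ : Bφ ≡ map lower B
  Bφ≡ with suc i <? n ∸ 1
  ... | yes i+1<n-1 = block-applyUpTo (φBlock n D) (n ∸ 1) (suc i) i+1<n-1
  ... | no  i+1≮n-1 =
    trans (block-applyUpTo-beyond (φBlock n D) (n ∸ 1) (suc i) (≮⇒≥ i+1≮n-1))
          (cong (map lower) (sym (rowCols-beyond (suc (suc i))
            (subst₂ _≤_ (m∸n+n≡m {n} {1} (≤-trans (s≤s z≤n) i+1<n)) (+-comm (suc i) 1) (+-monoˡ-≤ 1 (≮⇒≥ i+1≮n-1))))))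

  unpaired≡ : unpairedF (reverse Aφ) Bφ ≡ map lower (unpairedPD (reverse A) B)
  unpaired≡ = trans (cong₂ (λ a b → unpairedF (reverse a) b) Aφ≡ Bφ≡)
                    (trans (cong (λ as → unpairedF as (map lower B)) (sym (reverse-map upper A)))
                           (unpaired-correspondence (reverse A) B))

  module Unpaired (x : ℕ) (xs : List ℕ) (unpairedPD≡ : unpairedPD (reverse A) B ≡ x ∷ xs) where

    ℓ q : ℕ
    ℓ = maxOf x xs
    q = nextFree D (suc (suc i)) (suc (suc n)) (suc ℓ)

    E : PipeDream
    E = moveCross (suc i) D ℓ q

    unpairedF≡ : unpairedF (reverse Aφ) Bφ ≡ lower x ∷ map lower xs
    unpairedF≡ = trans unpaired≡ (cong (map lower) unpairedPD≡)

    v s : ℕ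
    v = maxOf (lower x) (map lower xs)
    s = nextGapF (suc (length Bφ)) Bφ v

    r′ : Fact
    r′ = moveLetter (suc i) (φ n D) (lower x) (map lower xs)

    lower-x∈Bφ : lower x ∈ Bφ
    lower-x∈Bφ = unpaired-⊆ (reverse Aφ) Bφ (subst (lower x ∈_) (sym unpairedF≡) (here refl))

    i+1<n-1 : suc i < n ∸ 1
    i+1<n-1 with suc i <? n ∸ 1
    ... | yes i+1<n-1 = i+1<n-1
    ... | no  i+1≮n-1 with () ← subst (lower x ∈_) (block-applyUpTo-beyond (φBlock n D) (n ∸ 1) (suc i) (≮⇒≥ i+1≮n-1)) lower-x∈Bφ

    Aφ≡φBlock : Aφ ≡ φBlock n D i
    Aφ≡φBlock = block-applyUpTo (φBlock n D) (n ∸ 1) i (<-trans (n<1+n i) i+1<n-1)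

    Bφ≡φBlock : Bφ ≡ φBlock n D (suc i)
    Bφ≡φBlock = block-applyUpTo (φBlock n D) (n ∸ 1) (suc i) i+1<n-1

    t : ℕ
    t = n ∸ 1 ∸ suc (suc i)

    n-1≡ : n ∸ 1 ≡ i + suc (suc t)
    n-1≡ = trans (sym (m+[n∸m]≡n i+1<n-1)) (sym (trans (+-suc i (suc t)) (cong suc (+-suc i t))))

    Lo Up : Fact
    Lo = applyUpTo (φBlock n D) i
    Up = applyUpTo (λ j → φBlock n D (i + suc (suc j))) t

    φD≡ : φ n D ≡ Lo ++ Aφ ∷ Bφ ∷ Up
    φD≡ = trans (cong (applyUpTo (φBlock n D)) n-1≡)
                (trans (applyUpTo-around (φBlock n D) i t)
                       (cong₂ (λ a b → Lo ++ a ∷ b ∷ Up) (sym Aφ≡φBlock) (sym Bφ≡φBlock)))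

    word≡ : word ≡ factWord Up ++ (Bφ ++ Aφ) ++ factWord Lo
    word≡ = trans (sym factWord-φ) (trans (cong factWord φD≡) (factWord-around Lo Aφ Bφ Up))

    Aφ-increasing : Increasing Aφ
    Aφ-increasing = subst Increasing (sym Aφ≡φBlock) (φBlock-increasing n D i)

    shape : Shape Aφ Bφ v s
    shape = AroundUnpaired.shape Aφ Bφ (lower x) (map lower xs) Aφ-increasing
              (subst Increasing (sym Bφ≡φBlock) (φBlock-increasing n D (suc i))) unpairedF≡

    open Shape shape
    open Exchange shape

    s≡i+q : s ≡ i + q
    s≡i+q = trans (cong₂ (λ bs z → nextGapF (suc (length bs)) bs z) Bφ≡row (trans (maxOf-lower x xs) (sym (+-suc i ℓ))))
                  (nextGap≡nextFree D (suc (suc i)) n i bounded (suc (suc n)) (suc (length row)) (suc ℓ)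
                     (s≤s (count-≤-length _ row)) (<-≤-trans (≤-trans (n<1+n n) (n≤1+n (suc n))) (m≤n+m (suc (suc n)) (suc ℓ))))
      where
      row : List ℕ
      row = map lower (filterᵇ (D (suc (suc i))) (range 1 n))
      Bφ≡row : Bφ ≡ row
      Bφ≡row = trans Bφ≡ (cong (map lower) (rowCols≡filter-range n D (suc (suc i))))
      bounded : ∀ c → D (suc (suc i)) c ≡ true → 1 ≤ c × c ≤ n
      bounded c cross with proj₁ (proj₁ rp) (suc (suc i)) c cross
      ... | _ , 1≤c , bound = 1≤c , ≤-trans (m≤n+m c (suc (suc i))) bound

    A₂-above-s : All (suc s ≤_) A₂
    A₂-above-s with s∈A-or-above Aφ-increasing
    ... | inj₁ A₂>s        = A₂>s
    ... | inj₂ (A₂′ , A₂≡) = ⊥-elim (word-minimal W′ same valid shorter)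
      where
      open Shortening A₂≡
      W′ : List ℕ
      W′ = factWord Up ++ Shortened ++ factWord Lo

      same : ∀ z → wordAct word z ≡ wordAct W′ z
      same z = trans (cong (λ ws → wordAct ws z) word≡) (wordAct-middle (factWord Up) (factWord Lo) shortened-word z)

      valid : All (ValidLetter n) W′
      valid with AllP.++⁻ (factWord Up) (subst (All (ValidLetter n)) word≡ crosses-valid)
      ... | up , rest with AllP.++⁻ (Bφ ++ Aφ) rest
      ... | middle , low = AllP.++⁺ up (AllP.++⁺ (shortened-all middle) low)

      shorter : length W′ < length word
      shorter = begin-strict
        length W′                                                        ≡⟨ length-middle (factWord Up) Shortened (factWord Lo) ⟩
        length (factWord Up) + (length Shortened + length (factWord Lo)) <⟨ +-monoʳ-< (length (factWord Up)) (+-monoˡ-< (length (factWord Lo)) (m<n+m (length Shortened) {2} z<s)) ⟩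
        length (factWord Up) + ((2 + length Shortened) + length (factWord Lo)) ≡⟨ cong (λ k → length (factWord Up) + (k + length (factWord Lo))) shortened-length ⟩
        length (factWord Up) + (length (Bφ ++ Aφ) + length (factWord Lo)) ≡⟨ sym (length-middle (factWord Up) (Bφ ++ Aφ) (factWord Lo)) ⟩
        length (factWord Up ++ (Bφ ++ Aφ) ++ factWord Lo)                 ≡⟨ cong length (sym word≡) ⟩
        length word                                                       ∎
        where open ≤-Reasoning

    s∉Aφ : s ∉ Aφ
    s∉Aφ s∈ with ∈-++⁻ A₁ (subst (s ∈_) A≡ s∈)
    ... | inj₁ s∈A₁ = <-irrefl refl (<-≤-trans (<-trans (n<1+n s) (All.lookup A₁< s∈A₁)) (subst (v ≤_) v+m≡s (m≤m+n v m)))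
    ... | inj₂ s∈R  with ∈-++⁻ Run⁻ s∈R
    ...   | inj₁ s∈Run⁻ = <-irrefl refl (subst (s <_) v+m≡s (proj₂ (All.lookup (range-bounds v m) s∈Run⁻)))
    ...   | inj₂ s∈A₂   = <-irrefl refl (All.lookup A₂-above-s s∈A₂)

    q-free : D (suc i) q ≡ false
    q-free with D (suc i) q in cross
    ... | false = refl
    ... | true  = ⊥-elim (s∉Aφ (subst (_∈ Aφ) (sym s≡i+q) (subst (upper q ∈_) (sym Aφ≡) (∈-map⁺ upper (cross∈rowCols cross)))))

    q-after-cross : ∃[ c ] (q ≡ suc c × D (suc (suc i)) c ≡ true)
    q-after-cross with ∈-map⁻ lower (subst (s ∈_) Bφ≡ s∈Bφ)
      where
      s∈Bφ : s ∈ Bφ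
      s∈Bφ = subst (s ∈_) (sym B≡) (∈-++⁺ʳ B₁ (∈-++⁺ˡ (∈-range⁺ v (suc m) (subst (v ≤_) v+m≡s (m≤m+n v m))
                                                 (subst (s <_) (sym (trans (+-suc v m) (cong suc v+m≡s))) (n<1+n s)))))
    ... | c , c∈B , s≡ = c , +-cancelˡ-≡ i q (suc c) (trans (sym s≡i+q) (trans s≡ (sym (+-suc i c)))) ,
                         rowCols⇒cross c∈B

    1≤q : 1 ≤ q
    1≤q = subst (1 ≤_) (sym (proj₁ (proj₂ q-after-cross))) (s≤s z≤n)

    i+1+q≤n : suc i + q ≤ n
    i+1+q≤n = subst (λ k → suc i + k ≤ n) (sym q≡)
                (subst (_≤ n) (sym (+-suc (suc i) c)) (proj₂ (proj₂ (proj₁ (proj₁ rp) (suc (suc i)) c cross))))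
      where
      c : ℕ
      c = proj₁ q-after-cross
      q≡ : q ≡ suc c
      q≡ = proj₁ (proj₂ q-after-cross)
      cross : D (suc (suc i)) c ≡ true
      cross = proj₂ (proj₂ q-after-cross)

    E-allowed : CrossesAllowed n E
    E-allowed = moveCross-allowed (suc i) D ℓ q (proj₁ (proj₁ rp)) (s≤s z≤n) 1≤q i+1+q≤n

    φBlock-E-other : ∀ {j} → j ≢ i → j ≢ suc i → φBlock n E j ≡ φBlock n D j
    φBlock-E-other j≢i j≢i+1 = cong (map _) (rowCols-moveCross-other (suc i) D ℓ q n (j≢i ∘ suc-injective) (j≢i+1 ∘ suc-injective))

    φBlock-E-inserted : φBlock n E i ≡ insertSorted s Aφ
    φBlock-E-inserted = begin
      map upper (rowCols n E (suc i))          ≡⟨ cong (map upper) (rowCols-moveCross-added (suc i) D ℓ q n 1≤q (≤-trans (m≤n+m q (suc i)) i+1+q≤n) q-free) ⟩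
      map upper (insertSorted q A)             ≡⟨ insertSorted-upper q A ⟩
      insertSorted (upper q) (map upper A)     ≡⟨ cong₂ insertSorted (sym s≡i+q) (sym Aφ≡) ⟩
      insertSorted s Aφ                        ∎
      where open ≡-Reasoning

    φBlock-E-removed : φBlock n E (suc i) ≡ removeFirst (v ≡ᵇ_) Bφ
    φBlock-E-removed = begin
      map lower (rowCols n E (suc (suc i)))             ≡⟨ cong (map lower) (rowCols-moveCross-removed (suc i) D ℓ q n) ⟩
      map lower (removeFirst (ℓ ≡ᵇ_) B)                 ≡⟨ removeFirst-lower ℓ B ⟩
      removeFirst (lower ℓ ≡ᵇ_) (map lower B)           ≡⟨ cong₂ (λ z bs → removeFirst (z ≡ᵇ_) bs) (sym (maxOf-lower x xs)) (sym Bφ≡) ⟩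
      removeFirst (v ≡ᵇ_) Bφ                            ∎
      where open ≡-Reasoning

    moved-blocks : Fact
    moved-blocks = Lo ++ insertSorted s Aφ ∷ removeFirst (v ≡ᵇ_) Bφ ∷ Up

    r′≡ : r′ ≡ moved-blocks
    r′≡ = trans (cong (updBlock (suc i) (insertSorted s) ∘ updBlock (suc (suc i)) (removeFirst (v ≡ᵇ_))) φD≡)
                (subst (λ k → updBlock (suc k) (insertSorted s) (updBlock (suc (suc k)) (removeFirst (v ≡ᵇ_)) (Lo ++ Aφ ∷ Bφ ∷ Up)) ≡ moved-blocks)
                       (length-applyUpTo (φBlock n D) i) (updBlock-at Lo (insertSorted s) (removeFirst (v ≡ᵇ_))))

    φE≡ : φ n E ≡ moved-blocks
    φE≡ = begin
      applyUpTo (φBlock n E) (n ∸ 1)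
        ≡⟨ cong (applyUpTo (φBlock n E)) n-1≡ ⟩
      applyUpTo (φBlock n E) (i + suc (suc t))
        ≡⟨ applyUpTo-around (φBlock n E) i t ⟩
      applyUpTo (φBlock n E) i ++ φBlock n E i ∷ φBlock n E (suc i) ∷ applyUpTo (λ j → φBlock n E (i + suc (suc j))) t
        ≡⟨ cong₂ (λ lo up → lo ++ φBlock n E i ∷ φBlock n E (suc i) ∷ up)
             (applyUpTo-cong-< i (λ j<i → φBlock-E-other (<⇒≢ j<i) (<⇒≢ (<-trans j<i (n<1+n i)))))
             (applyUpTo-cong (λ j → φBlock-E-other (>⇒≢ (m<m+n i z<s)) (>⇒≢ (subst (suc i <_) (sym (+-suc i (suc j))) (s≤s (m<m+n i z<s))))) t) ⟩
      Lo ++ φBlock n E i ∷ φBlock n E (suc i) ∷ Up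
        ≡⟨ cong₂ (λ a b → Lo ++ a ∷ b ∷ Up) φBlock-E-inserted φBlock-E-removed ⟩
      moved-blocks ∎
      where open ≡-Reasoning

    φE≡r′ : φ n E ≡ r′
    φE≡r′ = trans φE≡ (sym r′≡)

    private
      moved-middle : removeFirst (v ≡ᵇ_) Bφ ++ insertSorted s Aφ ≡ (B₁ ++ Run⁺ ++ B₂) ++ (A₁ ++ Run ++ A₂)
      moved-middle = cong₂ _++_ removed (inserted A₂-above-s)

      original-middle : Bφ ++ Aφ ≡ (B₁ ++ Run ++ B₂) ++ (A₁ ++ Run⁻ ++ A₂)
      original-middle = cong₂ _++_ B≡ A≡

      factWord-E : factWord (φ n E) ≡ factWord Up ++ (removeFirst (v ≡ᵇ_) Bφ ++ insertSorted s Aφ) ++ factWord Lo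
      factWord-E = trans (cong factWord φE≡) (factWord-around Lo (insertSorted s Aφ) (removeFirst (v ≡ᵇ_) Bφ) Up)

    word-E : ∀ z → wordAct (factWord (φ n E)) z ≡ wordAct word z
    word-E z = begin
      wordAct (factWord (φ n E)) z
        ≡⟨ cong (λ ws → wordAct ws z) (trans factWord-E (cong (λ m → factWord Up ++ m ++ factWord Lo) moved-middle)) ⟩
      wordAct (factWord Up ++ ((B₁ ++ Run⁺ ++ B₂) ++ (A₁ ++ Run ++ A₂)) ++ factWord Lo) z
        ≡⟨ wordAct-middle (factWord Up) (factWord Lo) exchange-word z ⟩
      wordAct (factWord Up ++ ((B₁ ++ Run ++ B₂) ++ (A₁ ++ Run⁻ ++ A₂)) ++ factWord Lo) z
        ≡⟨ cong (λ ws → wordAct ws z) (sym (trans word≡ (cong (λ m → factWord Up ++ m ++ factWord Lo) original-middle))) ⟩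
      wordAct word z ∎
      where open ≡-Reasoning

    length-E : length (factWord (φ n E)) ≡ length word
    length-E = begin
      length (factWord (φ n E))
        ≡⟨ cong length (trans factWord-E (cong (λ m → factWord Up ++ m ++ factWord Lo) moved-middle)) ⟩
      length (factWord Up ++ ((B₁ ++ Run⁺ ++ B₂) ++ (A₁ ++ Run ++ A₂)) ++ factWord Lo)
        ≡⟨ length-middle (factWord Up) _ (factWord Lo) ⟩
      length (factWord Up) + (length ((B₁ ++ Run⁺ ++ B₂) ++ (A₁ ++ Run ++ A₂)) + length (factWord Lo))
        ≡⟨ cong (λ k → length (factWord Up) + (k + length (factWord Lo))) exchange-length ⟩
      length (factWord Up) + (length ((B₁ ++ Run ++ B₂) ++ (A₁ ++ Run⁻ ++ A₂)) + length (factWord Lo))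
        ≡⟨ sym (length-middle (factWord Up) _ (factWord Lo)) ⟩
      length (factWord Up ++ ((B₁ ++ Run ++ B₂) ++ (A₁ ++ Run⁻ ++ A₂)) ++ factWord Lo)
        ≡⟨ cong length (sym (trans word≡ (cong (λ m → factWord Up ++ m ++ factWord Lo) original-middle))) ⟩
      length word ∎
      where open ≡-Reasoning

    r′-RFC : isRFCᵇ n (flip w) r′ ≡ true
    r′-RFC = subst (λ r → isRFCᵇ n (flip w) r ≡ true) φE≡r′
      (φ-isRFC n E (flip w) E-allowed (λ y → trans (word-E (suc (toℕ y))) (word-represents-inverse y)) (trans length-E length-word))

    ePD≡just : ePD n (suc i) D ≡ just E
    ePD≡just = ePD-unpaired n (suc i) D x xs unpairedPD≡

    eF≡just : eF n (flip w) (suc i) (φ n D) ≡ just r′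
    eF≡just = trans (eF-unpaired n (flip w) (suc i) (φ n D) (lower x) (map lower xs) unpairedF≡)
                    (cong (λ b → if b then just r′ else nothing) r′-RFC)

  module AllPaired (all-paired : unpairedPD (reverse A) B ≡ []) where

    ePD≡nothing : ePD n (suc i) D ≡ nothing
    ePD≡nothing = ePD-paired n (suc i) D all-paired

    eF≡nothing : eF n (flip w) (suc i) (φ n D) ≡ nothing
    eF≡nothing = eF-paired n (flip w) (suc i) (φ n D) (trans unpaired≡ (cong (map lower) all-paired))

corollary5p7 : (n : ℕ) (w : Permutation′ n) (D : PipeDream) → RP n w D →
    (i : ℕ) → 1 ≤ i → i < n →
    (Maybe.map (φ n) (ePD n i D) ≡ eF n (flip w) i (φ n D))
    × (ePD n i D ≡ nothing ⇔ eF n (flip w) i (φ n D) ≡ nothing)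
corollary5p7 n w D rp (suc i) _ i+1<n = by-pairing _ refl
  where
  open Raising n w D rp i i+1<n

  by-pairing : ∀ U → unpairedPD (reverse A) B ≡ U →
    (Maybe.map (φ n) (ePD n (suc i) D) ≡ eF n (flip w) (suc i) (φ n D))
    × (ePD n (suc i) D ≡ nothing ⇔ eF n (flip w) (suc i) (φ n D) ≡ nothing)
  by-pairing [] all-paired = trans (cong (Maybe.map (φ n)) ePD≡nothing) (sym eF≡nothing) ,
                             mk⇔ (λ _ → eF≡nothing) (λ _ → ePD≡nothing)
    where open AllPaired all-paired
  by-pairing (x ∷ xs) unpaired = trans (cong (Maybe.map (φ n)) ePD≡just) (trans (cong just φE≡r′) (sym eF≡just)) ,
                                 mk⇔ (λ ePD≡nothing → case trans (sym ePD≡just) ePD≡nothing of λ ())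
                                     (λ eF≡nothing → case trans (sym eF≡just) eF≡nothing of λ ())
    where open Unpaired x xs unpaired
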